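{- Let $p$ be a prime, $k\geq 0$ an integer and $\delta\in(0,1)$. Let $G=\mathbb{F}_p^n$, let $H\leqslant G$, and let $A\subseteq G$ have $\mathrm{VC}$-dimension at most $k$ relative to $H$. Then $$|\mathrm{Stab}_\delta(A)\cap H|\geq (\delta/30)^k|H|,$$ where $\mathrm{Stab}_\delta(A)=\{x\in G: |A\Delta(A+x)|\leq \delta|G|\}$.
   Context: For a finite abelian group $G$, a subgroup $H\leqslant G$ and $A\subseteq G$, $A$ has $\mathrm{VC}$-dimension at least $k\geq1$ relative to $H$ if there exist $x_1,\dots,x_k\in G$ and, for each $S\subseteq[k]$, some $y_S\in H$ such that $x_i+y_S\in A$ if and only if $i\in S$. The $\mathrm{VC}$-dimension of $A$ relative to $H$ is the largest such $k\geq 1$ if one exists, and $0$ otherwise.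
   Formalization: The parameter δ ranges over the rationals in $(0,1)$. -}

module Defs where

open import Data.Nat using (ℕ; zero; suc; NonZero) renaming (_+_ to _+ℕ_; _≤_ to _≤ℕ_)
open import Data.Nat.DivMod using (_mod_)
open import Data.Fin using (Fin; toℕ)
open import Data.Vec using (Vec; []; _∷_; zipWith; map)
open import Data.List using (List; []; _∷_; concatMap; length; filter) renaming (map to lmap)
open import Data.List using (allFin)
open import Data.Bool using (Bool; true; false; _xor_; _∧_; T)
open import Data.Product using (Σ; _×_)
open import Relation.Binary.PropositionalEquality using (_≡_)
open import Relation.Nullary using (¬_)
open import Relation.Unary using (Pred)
open import Data.Unit using (⊤)
open import Data.Bool.Properties using (T?)
open import Data.Rational using (ℚ; _*_; 1ℚ; _≤ᵇ_; _/_)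
open import Data.Integer using (+_)

G : ℕ → ℕ → Set
G p n = Vec (Fin p) n

module _ {p : ℕ} .{{_ : NonZero p}} where

  _+F_ : Fin p → Fin p → Fin p
  a +F b = (toℕ a +ℕ toℕ b) mod p

  negF : Fin p → Fin p
  negF a = (p Data.Nat.∸ toℕ a) mod p

  _⊕_ : ∀ {n} → G p n → G p n → G p n
  _⊕_ = zipWith _+F_

  ⊖_ : ∀ {n} → G p n → G p n
  ⊖_ = map negF

  0G : ∀ {n} → G p n
  0G {zero} = []
  0G {suc n} = (0 mod p) ∷ 0G

ℕtoℚ : ℕ → ℚ
ℕtoℚ m = (+ m) / 1

_^ℚ_ : ℚ → ℕ → ℚ
q ^ℚ zero = 1ℚ
q ^ℚ suc k = q * (q ^ℚ k)

SubsetG : ℕ → ℕ → Set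
SubsetG p n = G p n → Bool

allG : (p n : ℕ) → List (G p n)
allG p zero = [] ∷ []
allG p (suc n) = concatMap (λ a → lmap (a ∷_) (allG p n)) (allFin p)

∣_∣G : ∀ {p n} → SubsetG p n → ℕ
∣_∣G {p} {n} X = length (filter (λ x → T? (X x)) (allG p n))

module _ {p : ℕ} .{{_ : NonZero p}} {n : ℕ} where

  record IsSubgroup (H : SubsetG p n) : Set where
    field
      zero∈ : H 0G ≡ true
      +-closed : ∀ x y → H x ≡ true → H y ≡ true → H (x ⊕ y) ≡ true
      neg-closed : ∀ x → H x ≡ true → H (⊖ x) ≡ true

  VCdimAtLeast : (H A : SubsetG p n) → ℕ → Set
  VCdimAtLeast H A d =
    Σ (Fin d → G p n) λ x →
      (S : Fin d → Bool) →
        Σ (G p n) λ y → (H y ≡ true) × (∀ i → A (x i ⊕ y) ≡ S i)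

  VCdimAtMost : (H A : SubsetG p n) → ℕ → Set
  VCdimAtMost H A k = ∀ d → 1 ≤ℕ d → VCdimAtLeast H A d → d ≤ℕ k

  -- translate A + x = { a + x : a ∈ A }, i.e. y ∈ A + x ⟺ y - x ∈ A
  translate : SubsetG p n → G p n → SubsetG p n
  translate A x y = A (y ⊕ (⊖ x))

  _Δ_ : SubsetG p n → SubsetG p n → SubsetG p n
  (A Δ B) y = A y xor B y

  Stab : ℚ → SubsetG p n → SubsetG p n
  Stab δ A x = ℕtoℚ ∣ A Δ translate A x ∣G ≤ᵇ δ * ℕtoℚ ∣ (λ (_ : G p n) → true) ∣G

  _∩_ : SubsetG p n → SubsetG p n → SubsetG p n
  (A ∩ B) y = A y ∧ B y

{-# OPTIONS --safe #-}
module Submission where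

-- Write δ = a/b and let C be a maximal subset of H whose translates A − c are pairwise more than
-- δ|G| apart. Every h ∈ H is within δ|G| of some A − c with c ∈ C, and then h − c ∈ Stab_δ(A) ∩ H;
-- hence |H| ≤ |C| · |Stab_δ(A) ∩ H|. The translates A − c (c ∈ C) form a δ-separated family of
-- VC-dimension at most k, so Haussler's packing lemma bounds |C| by (30/δ)^k.
--
-- Haussler's argument: restrict the family to samples of s + 1 ≈ 4k/δ points. In the one-inclusion
-- graph of the restricted family the number of edges is at most k times the number of members
-- (compression), while separation forces every point of a sample to cut many edges through the
-- members that agree on the other s points: at least δ/2 times their number minus one, on average.
-- Sauer–Shelah bounds the number of patterns on s points by Φ(k, s), and comparing both counts gives
-- |C| ≤ 2 Φ(k, s) ≤ (30/δ)^k.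

open import Data.List using (List)
open import Data.Nat using (ℕ; NonZero)
open import Data.Rational using (ℚ; toℚᵘ)
open import Relation.Nullary using (Dec)
open import Defs

module FiniteSums where

  open import Data.Nat
  open import Data.Nat.Properties
  open import Algebra.Properties.CommutativeSemigroup +-commutativeSemigroup using (interchange)
  import Algebra.Properties.CommutativeMonoid.Sum +-0-commutativeMonoid as FinSum
  open FinSum using (sum-cong-≗; ∑-distrib-+; sum-replicate-zero)
  open import Data.Bool using (Bool; true; false)
  open import Data.Fin using (Fin; zero; suc)
  open import Data.List using (List; []; _∷_; _++_; length; filter; concatMap) renaming (map to mapL)
  open import Data.List.Membership.Propositional using (_∈_)
  open import Data.List.Relation.Unary.Any using (here; there)
  open import Data.List.Relation.Unary.All using (All; []; _∷_)
  open import Data.Vec using (Vec; []; _∷_)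
  open import Relation.Nullary using (does)
  open import Relation.Unary using (Decidable)
  open import Relation.Binary.PropositionalEquality

  open FinSum public using () renaming (sum to Σfin)

  𝟙 : Bool → ℕ
  𝟙 true = 1
  𝟙 false = 0

  record IsSum {B : Set} (S : (B → ℕ) → ℕ) : Set where
    field
      sum-cong : ∀ {f g : B → ℕ} → (∀ b → f b ≡ g b) → S f ≡ S g
      sum-+ : ∀ (f g : B → ℕ) → S (λ b → f b + g b) ≡ S f + S g
      sum-0 : S (λ _ → 0) ≡ 0

    sum-mono-≤ : ∀ {f g : B → ℕ} → (∀ b → f b ≤ g b) → S f ≤ S g
    sum-mono-≤ {f} {g} f≤g = begin
      S f                          ≤⟨ m≤m+n (S f) _ ⟩
      S f + S (λ b → g b ∸ f b)    ≡⟨ sum-+ f _ ⟨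
      S (λ b → f b + (g b ∸ f b))  ≡⟨ sum-cong (λ b → m+[n∸m]≡n (f≤g b)) ⟩
      S g                          ∎
      where open ≤-Reasoning

    sum-zero : ∀ {f : B → ℕ} → (∀ b → f b ≡ 0) → S f ≡ 0
    sum-zero f≡0 = trans (sum-cong f≡0) sum-0

    *-sum : ∀ (c : ℕ) (f : B → ℕ) → c * S f ≡ S (λ b → c * f b)
    *-sum zero f = sym sum-0
    *-sum (suc c) f = trans (cong (S f +_) (*-sum c f)) (sym (sum-+ f _))

    sum-* : ∀ (c : ℕ) (f : B → ℕ) → S f * c ≡ S (λ b → f b * c)
    sum-* c f = trans (*-comm (S f) c) (trans (*-sum c f) (sum-cong (λ b → *-comm c (f b))))

    *-sum-mono-≤ : ∀ (c d : ℕ) {f g : B → ℕ} → (∀ b → c * f b ≤ d * g b) → c * S f ≤ d * S g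
    *-sum-mono-≤ c d {f} {g} cf≤dg = begin
      c * S f              ≡⟨ *-sum c f ⟩
      S (λ b → c * f b)    ≤⟨ sum-mono-≤ cf≤dg ⟩
      S (λ b → d * g b)    ≡⟨ *-sum d g ⟨
      d * S g              ∎
      where open ≤-Reasoning

  Σlist : ∀ {A : Set} → List A → (A → ℕ) → ℕ
  Σlist [] f = 0
  Σlist (x ∷ xs) f = f x + Σlist xs f

  Σlist-isSum : ∀ {A : Set} (xs : List A) → IsSum (Σlist xs)
  Σlist-isSum {A} xs = record { sum-cong = respects-≗ xs ; sum-+ = distrib-+ xs ; sum-0 = of-zero xs }
    where
    respects-≗ : ∀ (xs : List A) {f g : A → ℕ} → (∀ b → f b ≡ g b) → Σlist xs f ≡ Σlist xs g
    respects-≗ [] f≡g = refl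
    respects-≗ (x ∷ xs) f≡g = cong₂ _+_ (f≡g x) (respects-≗ xs f≡g)
    distrib-+ : ∀ (xs : List A) (f g : A → ℕ) → Σlist xs (λ b → f b + g b) ≡ Σlist xs f + Σlist xs g
    distrib-+ [] f g = refl
    distrib-+ (x ∷ xs) f g = trans (cong (f x + g x +_) (distrib-+ xs f g)) (interchange (f x) (g x) _ _)
    of-zero : ∀ (xs : List A) → Σlist xs (λ _ → 0) ≡ 0
    of-zero [] = refl
    of-zero (x ∷ xs) = of-zero xs

  Σlist-swap : ∀ {A B : Set} {S : (B → ℕ) → ℕ} → IsSum S → (xs : List A) (f : A → B → ℕ) →
    Σlist xs (λ x → S (f x)) ≡ S (λ b → Σlist xs (λ x → f x b))
  Σlist-swap isS [] f = sym (IsSum.sum-0 isS)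
  Σlist-swap {S = S} isS (x ∷ xs) f =
    trans (cong (S (f x) +_) (Σlist-swap isS xs f)) (sym (IsSum.sum-+ isS (f x) _))

  Σlist-* : ∀ {A B : Set} (xs : List A) (ys : List B) (f : A → ℕ) (g : B → ℕ) →
    Σlist xs f * Σlist ys g ≡ Σlist xs (λ x → Σlist ys (λ y → f x * g y))
  Σlist-* xs ys f g = begin
    Σlist xs f * Σlist ys g                         ≡⟨ sum-* (Σlist ys g) f ⟩
    Σlist xs (λ x → f x * Σlist ys g)               ≡⟨ sum-cong (λ x → IsSum.*-sum (Σlist-isSum ys) (f x) g) ⟩
    Σlist xs (λ x → Σlist ys (λ y → f x * g y))     ∎
    where
    open ≡-Reasoning
    open IsSum (Σlist-isSum xs)


  Σlist-const : ∀ {A : Set} (xs : List A) (c : ℕ) → Σlist xs (λ _ → c) ≡ length xs * c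
  Σlist-const [] c = refl
  Σlist-const (x ∷ xs) c = cong (c +_) (Σlist-const xs c)

  Σlist-++ : ∀ {A : Set} (xs ys : List A) (f : A → ℕ) → Σlist (xs ++ ys) f ≡ Σlist xs f + Σlist ys f
  Σlist-++ [] ys f = refl
  Σlist-++ (x ∷ xs) ys f = trans (cong (f x +_) (Σlist-++ xs ys f)) (sym (+-assoc (f x) _ _))

  Σlist-map : ∀ {A B : Set} (g : A → B) (xs : List A) (f : B → ℕ) → Σlist (mapL g xs) f ≡ Σlist xs (λ x → f (g x))
  Σlist-map g [] f = refl
  Σlist-map g (x ∷ xs) f = cong (f (g x) +_) (Σlist-map g xs f)

  Σlist-concatMap : ∀ {A B : Set} (g : A → List B) (xs : List A) (f : B → ℕ) →
    Σlist (concatMap g xs) f ≡ Σlist xs (λ x → Σlist (g x) f)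
  Σlist-concatMap g [] f = refl
  Σlist-concatMap g (x ∷ xs) f = trans (Σlist-++ (g x) (concatMap g xs) f) (cong (Σlist (g x) f +_) (Σlist-concatMap g xs f))

  Σlist-filter : ∀ {A : Set} {P : A → Set} (P? : Decidable P) (xs : List A) (f : A → ℕ) →
    Σlist (filter P? xs) f ≡ Σlist xs (λ x → 𝟙 (does (P? x)) * f x)
  Σlist-filter P? [] f = refl
  Σlist-filter P? (x ∷ xs) f with does (P? x)
  ... | true = cong₂ _+_ (sym (+-identityʳ (f x))) (Σlist-filter P? xs f)
  ... | false = Σlist-filter P? xs f

  length-filter≡Σlist : ∀ {A : Set} {P : A → Set} (P? : Decidable P) (xs : List A) →
    length (filter P? xs) ≡ Σlist xs (λ x → 𝟙 (does (P? x)))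
  length-filter≡Σlist P? [] = refl
  length-filter≡Σlist P? (x ∷ xs) with does (P? x)
  ... | true = cong suc (length-filter≡Σlist P? xs)
  ... | false = length-filter≡Σlist P? xs

  ∈⇒≤Σlist : ∀ {A : Set} {xs : List A} {x} (f : A → ℕ) → x ∈ xs → f x ≤ Σlist xs f
  ∈⇒≤Σlist f (here refl) = m≤m+n _ _
  ∈⇒≤Σlist {xs = y ∷ xs} f (there x∈xs) = ≤-trans (∈⇒≤Σlist f x∈xs) (m≤n+m _ (f y))

  All⇒length*≤Σlist : ∀ {A : Set} {K : ℕ} {f : A → ℕ} (xs : List A) → All (λ x → K ≤ f x) xs →
    length xs * K ≤ Σlist xs f
  All⇒length*≤Σlist [] [] = z≤n
  All⇒length*≤Σlist (x ∷ xs) (K≤fx ∷ K≤f) = +-mono-≤ K≤fx (All⇒length*≤Σlist xs K≤f)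

  Σlist-mono-∈ : ∀ {A : Set} (xs : List A) {f g : A → ℕ} → (∀ x → x ∈ xs → f x ≤ g x) → Σlist xs f ≤ Σlist xs g
  Σlist-mono-∈ [] f≤g = z≤n
  Σlist-mono-∈ (x ∷ xs) f≤g = +-mono-≤ (f≤g x (here refl)) (Σlist-mono-∈ xs (λ y y∈xs → f≤g y (there y∈xs)))

  Σfin-isSum : ∀ s → IsSum (Σfin {s})
  Σfin-isSum s = record { sum-cong = sum-cong-≗ ; sum-+ = ∑-distrib-+ ; sum-0 = sum-replicate-zero s }

  Σfin-const : ∀ s (c : ℕ) → Σfin {s} (λ _ → c) ≡ s * c
  Σfin-const zero c = refl
  Σfin-const (suc s) c = cong (c +_) (Σfin-const s c)

  Σfin-swap : ∀ {B : Set} {S : (B → ℕ) → ℕ} → IsSum S → ∀ s (f : Fin s → B → ℕ) →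
    Σfin (λ j → S (f j)) ≡ S (λ b → Σfin (λ j → f j b))
  Σfin-swap isS zero f = sym (IsSum.sum-0 isS)
  Σfin-swap {S = S} isS (suc s) f =
    trans (cong (S (f zero) +_) (Σfin-swap isS s (λ j → f (suc j)))) (sym (IsSum.sum-+ isS (f zero) _))

  Σcube : ∀ {s} → (Vec Bool s → ℕ) → ℕ
  Σcube {zero} f = f []
  Σcube {suc s} f = Σcube (λ q → f (false ∷ q)) + Σcube (λ q → f (true ∷ q))

  Σcube-isSum : ∀ s → IsSum (Σcube {s})
  Σcube-isSum s = record { sum-cong = respects-≗ s ; sum-+ = distrib-+ s ; sum-0 = of-zero s }
    where
    respects-≗ : ∀ s {f g : Vec Bool s → ℕ} → (∀ b → f b ≡ g b) → Σcube f ≡ Σcube g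
    respects-≗ zero f≡g = f≡g []
    respects-≗ (suc s) f≡g = cong₂ _+_ (respects-≗ s (λ q → f≡g (false ∷ q))) (respects-≗ s (λ q → f≡g (true ∷ q)))
    distrib-+ : ∀ s (f g : Vec Bool s → ℕ) → Σcube (λ b → f b + g b) ≡ Σcube f + Σcube g
    distrib-+ zero f g = refl
    distrib-+ (suc s) f g =
      trans (cong₂ _+_ (distrib-+ s (λ q → f (false ∷ q)) (λ q → g (false ∷ q)))
                       (distrib-+ s (λ q → f (true ∷ q)) (λ q → g (true ∷ q))))
            (interchange (Σcube (λ q → f (false ∷ q))) (Σcube (λ q → g (false ∷ q))) _ _)
    of-zero : ∀ s → Σcube {s} (λ _ → 0) ≡ 0
    of-zero zero = refl
    of-zero (suc s) = cong₂ _+_ (of-zero s) (of-zero s)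

  module Tuples {X : Set} (xs : List X) where

    Σtuple : ∀ {s} → (Vec X s → ℕ) → ℕ
    Σtuple {zero} f = f []
    Σtuple {suc s} f = Σlist xs (λ x → Σtuple (λ I → f (x ∷ I)))

    Σtuple-isSum : ∀ s → IsSum (Σtuple {s})
    Σtuple-isSum s = record { sum-cong = respects-≗ s ; sum-+ = distrib-+ s ; sum-0 = of-zero s }
      where
      open IsSum (Σlist-isSum xs)
      respects-≗ : ∀ s {f g : Vec X s → ℕ} → (∀ b → f b ≡ g b) → Σtuple f ≡ Σtuple g
      respects-≗ zero f≡g = f≡g []
      respects-≗ (suc s) f≡g = sum-cong (λ x → respects-≗ s (λ I → f≡g (x ∷ I)))
      distrib-+ : ∀ s (f g : Vec X s → ℕ) → Σtuple (λ b → f b + g b) ≡ Σtuple f + Σtuple g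
      distrib-+ zero f g = refl
      distrib-+ (suc s) f g = trans (sum-cong (λ x → distrib-+ s (λ I → f (x ∷ I)) (λ I → g (x ∷ I)))) (sum-+ _ _)
      of-zero : ∀ s → Σtuple {s} (λ _ → 0) ≡ 0
      of-zero zero = refl
      of-zero (suc s) = sum-zero (λ x → of-zero s)

    Σtuple-const : ∀ s (c : ℕ) → Σtuple {s} (λ _ → c) ≡ length xs ^ s * c
    Σtuple-const zero c = sym (+-identityʳ c)
    Σtuple-const (suc s) c = begin
      Σlist xs (λ x → Σtuple {s} (λ _ → c)) ≡⟨ IsSum.sum-cong (Σlist-isSum xs) (λ x → Σtuple-const s c) ⟩
      Σlist xs (λ x → length xs ^ s * c)    ≡⟨ Σlist-const xs _ ⟩
      length xs * (length xs ^ s * c)       ≡⟨ *-assoc (length xs) _ c ⟨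
      length xs ^ suc s * c                 ∎
      where open ≡-Reasoning

module Hypercube where

  open import Data.Nat
  open import Data.Nat.Properties
  open import Algebra.Properties.CommutativeSemigroup +-commutativeSemigroup using (interchange)
  open import Data.Nat.Solver using (module +-*-Solver)
  open +-*-Solver using (solve; _:+_; _:*_; _:=_; con)
  open import Data.Bool using (Bool; true; false)
  open import Data.Vec using (Vec; []; _∷_; lookup)
  open import Data.Fin using (Fin; zero; suc)
  open import Data.Product using (Σ; _×_; _,_)
  open import Data.Sum using (_⊎_; inj₁; inj₂)
  open import Relation.Nullary using (contradiction)
  open import Relation.Binary.PropositionalEquality
  open FiniteSums

  -- A weight w on the cube {0,1}^s counts, for each pattern, the members of a family with that
  -- pattern. The weighted one-inclusion graph joins two patterns differing in one coordinate by
  -- an edge of weight the smaller of their two weights.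
  edges-along : ∀ {s} → Fin s → (Vec Bool s → ℕ) → ℕ
  edges-along {suc s} zero w = Σcube (λ q → w (false ∷ q) ⊓ w (true ∷ q))
  edges-along {suc s} (suc j) w = edges-along j (λ q → w (false ∷ q)) + edges-along j (λ q → w (true ∷ q))

  edges : ∀ {s} → (Vec Bool s → ℕ) → ℕ
  edges w = Σfin (λ j → edges-along j w)

  Shatters : ∀ {s d} → (Vec Bool s → ℕ) → (Fin d → Fin s) → Set
  Shatters {s} {d} w J = (S : Fin d → Bool) → Σ (Vec Bool s) λ q → (0 < w q) × (∀ i → lookup q (J i) ≡ S i)

  VCdim≤ : ∀ {s} → ℕ → (Vec Bool s → ℕ) → Set
  VCdim≤ {s} k w = ∀ d (J : Fin d → Fin s) → Shatters w J → d ≤ k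

  -- Φ k s = Σ_{i ≤ k} C(s, i), the Sauer–Shelah bound.
  Φ : ℕ → ℕ → ℕ
  Φ k zero = 1
  Φ zero (suc s) = 1
  Φ (suc k) (suc s) = Φ (suc k) s + Φ k s

  sign : ℕ → ℕ
  sign zero = 0
  sign (suc _) = 1

  sign≤1 : ∀ m → sign m ≤ 1
  sign≤1 zero = z≤n
  sign≤1 (suc m) = s≤s z≤n

  m+n≡m⊔n+m⊓n : ∀ m n → m + n ≡ m ⊔ n + m ⊓ n
  m+n≡m⊔n+m⊓n zero n = sym (+-identityʳ n)
  m+n≡m⊔n+m⊓n (suc m) zero = refl
  m+n≡m⊔n+m⊓n (suc m) (suc n) =
    cong suc (trans (+-suc m n) (trans (cong suc (m+n≡m⊔n+m⊓n m n)) (sym (+-suc (m ⊔ n) (m ⊓ n)))))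

  sign-m+n≡sign-m⊔n+sign-m⊓n : ∀ m n → sign m + sign n ≡ sign (m ⊔ n) + sign (m ⊓ n)
  sign-m+n≡sign-m⊔n+sign-m⊓n zero zero = refl
  sign-m+n≡sign-m⊔n+sign-m⊓n zero (suc n) = refl
  sign-m+n≡sign-m⊔n+sign-m⊓n (suc m) zero = refl
  sign-m+n≡sign-m⊔n+sign-m⊓n (suc m) (suc n) = refl

  0<m⊔n⇒0<m⊎0<n : ∀ m n → 0 < m ⊔ n → (0 < m) ⊎ (0 < n)
  0<m⊔n⇒0<m⊎0<n zero n 0<n = inj₂ 0<n
  0<m⊔n⇒0<m⊎0<n (suc m) n _ = inj₁ (s≤s z≤n)

  ⊓-cross : ∀ {x X y Y} → x ≤ X → y ≤ Y → x ⊓ Y + X ⊓ y ≤ X ⊓ Y + x ⊓ y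
  ⊓-cross {X = X} {y} {Y} z≤n y≤Y = ≤-trans (⊓-monoʳ-≤ X y≤Y) (m≤m+n _ 0)
  ⊓-cross {suc x} {suc X} {zero} {Y} (s≤s x≤X) z≤n = +-monoˡ-≤ 0 (⊓-mono-≤ (s≤s x≤X) (≤-refl {Y}))
  ⊓-cross {suc x} {suc X} {suc y} {suc Y} (s≤s x≤X) (s≤s y≤Y) =
    subst₂ _≤_ (sym (cong suc (+-suc (x ⊓ Y) (X ⊓ y)))) (sym (cong suc (+-suc (X ⊓ Y) (x ⊓ y))))
      (s≤s (s≤s (⊓-cross x≤X y≤Y)))

  ⊓-sorting : ∀ a₀ a₁ b₀ b₁ → a₀ ⊓ b₀ + a₁ ⊓ b₁ ≤ (a₀ ⊔ a₁) ⊓ (b₀ ⊔ b₁) + (a₀ ⊓ a₁) ⊓ (b₀ ⊓ b₁)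
  ⊓-sorting a₀ a₁ b₀ b₁ with ≤-total a₀ a₁ | ≤-total b₀ b₁
  ... | inj₁ a₀≤a₁ | inj₁ b₀≤b₁
    rewrite m≤n⇒m⊔n≡n a₀≤a₁ | m≤n⇒m⊔n≡n b₀≤b₁ | m≤n⇒m⊓n≡m a₀≤a₁ | m≤n⇒m⊓n≡m b₀≤b₁ =
    ≤-reflexive (+-comm (a₀ ⊓ b₀) (a₁ ⊓ b₁))
  ... | inj₁ a₀≤a₁ | inj₂ b₁≤b₀
    rewrite m≤n⇒m⊔n≡n a₀≤a₁ | m≥n⇒m⊔n≡m b₁≤b₀ | m≤n⇒m⊓n≡m a₀≤a₁ | m≥n⇒m⊓n≡n b₁≤b₀ =
    ⊓-cross a₀≤a₁ b₁≤b₀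
  ... | inj₂ a₁≤a₀ | inj₁ b₀≤b₁
    rewrite m≥n⇒m⊔n≡m a₁≤a₀ | m≤n⇒m⊔n≡n b₀≤b₁ | m≥n⇒m⊓n≡n a₁≤a₀ | m≤n⇒m⊓n≡m b₀≤b₁ =
    subst (_≤ a₀ ⊓ b₁ + a₁ ⊓ b₀) (+-comm (a₁ ⊓ b₁) (a₀ ⊓ b₀)) (⊓-cross a₁≤a₀ b₀≤b₁)
  ... | inj₂ a₁≤a₀ | inj₂ b₁≤b₀
    rewrite m≥n⇒m⊔n≡m a₁≤a₀ | m≥n⇒m⊔n≡m b₁≤b₀ | m≥n⇒m⊓n≡n a₁≤a₀ | m≥n⇒m⊓n≡n b₁≤b₀ = ≤-refl

  edges-along-⊔⊓ : ∀ {s} (j : Fin s) (u v : Vec Bool s → ℕ) →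
    edges-along j u + edges-along j v ≤ edges-along j (λ q → u q ⊔ v q) + edges-along j (λ q → u q ⊓ v q)
  edges-along-⊔⊓ {suc s} zero u v = begin
    Σcube (λ q → u (false ∷ q) ⊓ u (true ∷ q)) + Σcube (λ q → v (false ∷ q) ⊓ v (true ∷ q))
      ≡⟨ sum-+ _ _ ⟨
    Σcube (λ q → u (false ∷ q) ⊓ u (true ∷ q) + v (false ∷ q) ⊓ v (true ∷ q))
      ≤⟨ sum-mono-≤ (λ q → ⊓-sorting (u (false ∷ q)) (v (false ∷ q)) (u (true ∷ q)) (v (true ∷ q))) ⟩
    Σcube (λ q → (u (false ∷ q) ⊔ v (false ∷ q)) ⊓ (u (true ∷ q) ⊔ v (true ∷ q))
               + (u (false ∷ q) ⊓ v (false ∷ q)) ⊓ (u (true ∷ q) ⊓ v (true ∷ q)))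
      ≡⟨ sum-+ _ _ ⟩
    _ ∎
    where
    open ≤-Reasoning
    open IsSum (Σcube-isSum s)
  edges-along-⊔⊓ {suc s} (suc j) u v = begin
    (u₀ + u₁) + (v₀ + v₁)  ≡⟨ interchange u₀ u₁ v₀ v₁ ⟩
    (u₀ + v₀) + (u₁ + v₁)  ≤⟨ +-mono-≤ (edges-along-⊔⊓ j _ _) (edges-along-⊔⊓ j _ _) ⟩
    (M₀ + m₀) + (M₁ + m₁)  ≡⟨ interchange M₀ m₀ M₁ m₁ ⟩
    (M₀ + M₁) + (m₀ + m₁)  ∎
    where
    open ≤-Reasoning
    u₀ u₁ v₀ v₁ M₀ M₁ m₀ m₁ : ℕ
    u₀ = edges-along j (λ q → u (false ∷ q))
    u₁ = edges-along j (λ q → u (true ∷ q))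
    v₀ = edges-along j (λ q → v (false ∷ q))
    v₁ = edges-along j (λ q → v (true ∷ q))
    M₀ = edges-along j (λ q → u (false ∷ q) ⊔ v (false ∷ q))
    M₁ = edges-along j (λ q → u (true ∷ q) ⊔ v (true ∷ q))
    m₀ = edges-along j (λ q → u (false ∷ q) ⊓ v (false ∷ q))
    m₁ = edges-along j (λ q → u (true ∷ q) ⊓ v (true ∷ q))

  edges-along-zero : ∀ {s} (j : Fin s) (w : Vec Bool s → ℕ) → (∀ q → w q ≡ 0) → edges-along j w ≡ 0
  edges-along-zero {suc s} zero w w≡0 =
    IsSum.sum-zero (Σcube-isSum s) (λ q → cong (_⊓ w (true ∷ q)) (w≡0 (false ∷ q)))
  edges-along-zero {suc s} (suc j) w w≡0 =
    cong₂ _+_ (edges-along-zero j _ (λ q → w≡0 (false ∷ q))) (edges-along-zero j _ (λ q → w≡0 (true ∷ q)))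

  edges-zero : ∀ {s} (w : Vec Bool s → ℕ) → (∀ q → w q ≡ 0) → edges w ≡ 0
  edges-zero {s} w w≡0 = IsSum.sum-zero (Σfin-isSum s) (λ j → edges-along-zero j w w≡0)

  module Compression {s : ℕ} (w : Vec Bool (suc s) → ℕ) where

    w₀ w₁ w⊔ w⊓ : Vec Bool s → ℕ
    w₀ q = w (false ∷ q)
    w₁ q = w (true ∷ q)
    w⊔ q = w₀ q ⊔ w₁ q
    w⊓ q = w₀ q ⊓ w₁ q

    VCdim-w⊔ : ∀ {k} → VCdim≤ k w → VCdim≤ k w⊔
    VCdim-w⊔ vc d J shatters = vc d (λ i → suc (J i)) shatters′
      where
      shatters′ : Shatters w (λ i → suc (J i))
      shatters′ S with shatters S
      ... | q , 0<w⊔ , q|J≡S with 0<m⊔n⇒0<m⊎0<n (w₀ q) (w₁ q) 0<w⊔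
      ...   | inj₁ 0<w₀ = (false ∷ q) , 0<w₀ , q|J≡S
      ...   | inj₂ 0<w₁ = (true ∷ q) , 0<w₁ , q|J≡S

    -- A set shattered by w⊓ is shattered by w together with the first coordinate.
    shatters-w⊓ : ∀ {k} → VCdim≤ k w → ∀ d (J : Fin d → Fin s) → Shatters w⊓ J → suc d ≤ k
    shatters-w⊓ vc d J shatters = vc (suc d) J′ shatters′
      where
      J′ : Fin (suc d) → Fin (suc s)
      J′ zero = zero
      J′ (suc i) = suc (J i)
      shatters′ : Shatters w J′
      shatters′ S with shatters (λ i → S (suc i))
      ... | q , 0<w⊓ , q|J≡S = (S zero ∷ q) , 0<w (S zero) , lookup≡S
        where
        0<w : ∀ b → 0 < w (b ∷ q)
        0<w false = m<n⊓o⇒m<n (w₀ q) (w₁ q) 0<w⊓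
        0<w true = m<n⊓o⇒m<o (w₀ q) (w₁ q) 0<w⊓
        lookup≡S : ∀ i → lookup (S zero ∷ q) (J′ i) ≡ S i
        lookup≡S zero = refl
        lookup≡S (suc i) = q|J≡S i

    VCdim-w⊓ : ∀ {k} → VCdim≤ (suc k) w → VCdim≤ k w⊓
    VCdim-w⊓ vc d J shatters = s≤s⁻¹ (shatters-w⊓ vc d J shatters)

    w⊓≡0 : VCdim≤ 0 w → ∀ q → w⊓ q ≡ 0
    w⊓≡0 vc q with w⊓ q in eq
    ... | zero = refl
    ... | suc _ = contradiction (shatters-w⊓ vc 0 (λ ()) (λ S → q , subst (0 <_) (sym eq) (s≤s z≤n) , λ ())) 1+n≰n

    Σcube-w : Σcube w ≡ Σcube w⊔ + Σcube w⊓
    Σcube-w = begin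
      Σcube w₀ + Σcube w₁            ≡⟨ sum-+ w₀ w₁ ⟨
      Σcube (λ q → w₀ q + w₁ q)      ≡⟨ sum-cong (λ q → m+n≡m⊔n+m⊓n (w₀ q) (w₁ q)) ⟩
      Σcube (λ q → w⊔ q + w⊓ q)      ≡⟨ sum-+ w⊔ w⊓ ⟩
      Σcube w⊔ + Σcube w⊓            ∎
      where
      open ≡-Reasoning
      open IsSum (Σcube-isSum s)

    support-w : Σcube (λ q → sign (w q)) ≡ Σcube (λ q → sign (w⊔ q)) + Σcube (λ q → sign (w⊓ q))
    support-w = begin
      Σcube (λ q → sign (w₀ q)) + Σcube (λ q → sign (w₁ q))   ≡⟨ sum-+ _ _ ⟨
      Σcube (λ q → sign (w₀ q) + sign (w₁ q))                ≡⟨ sum-cong (λ q → sign-m+n≡sign-m⊔n+sign-m⊓n (w₀ q) (w₁ q)) ⟩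
      Σcube (λ q → sign (w⊔ q) + sign (w⊓ q))                ≡⟨ sum-+ _ _ ⟩
      Σcube (λ q → sign (w⊔ q)) + Σcube (λ q → sign (w⊓ q))  ∎
      where
      open ≡-Reasoning
      open IsSum (Σcube-isSum s)

    edges-w : edges w ≤ Σcube w⊓ + (edges w⊔ + edges w⊓)
    edges-w = +-monoʳ-≤ (Σcube w⊓) (begin
      Σfin (λ j → edges-along j w₀ + edges-along j w₁)          ≤⟨ sum-mono-≤ (λ j → edges-along-⊔⊓ j w₀ w₁) ⟩
      Σfin (λ j → edges-along j w⊔ + edges-along j w⊓)          ≡⟨ sum-+ (λ j → edges-along j w⊔) (λ j → edges-along j w⊓) ⟩
      edges w⊔ + edges w⊓                                       ∎)
      where
      open ≤-Reasoning
      open IsSum (Σfin-isSum s)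

  edges≤VCdim*Σcube : ∀ s k (w : Vec Bool s → ℕ) → VCdim≤ k w → edges w ≤ k * Σcube w
  edges≤VCdim*Σcube zero k w vc = z≤n
  edges≤VCdim*Σcube (suc s) zero w vc = ≤-trans edges-w (≤-reflexive (begin
    Σcube w⊓ + (edges w⊔ + edges w⊓)  ≡⟨ cong₂ _+_ (IsSum.sum-zero (Σcube-isSum s) (w⊓≡0 vc)) (cong₂ _+_ edges-w⊔≡0 (edges-zero w⊓ (w⊓≡0 vc))) ⟩
    0                                  ∎))
    where
    open Compression w
    open ≡-Reasoning
    edges-w⊔≡0 : edges w⊔ ≡ 0
    edges-w⊔≡0 = n≤0⇒n≡0 (edges≤VCdim*Σcube s 0 w⊔ (VCdim-w⊔ vc))
  edges≤VCdim*Σcube (suc s) (suc k) w vc = begin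
    edges w                                          ≤⟨ edges-w ⟩
    Σcube w⊓ + (edges w⊔ + edges w⊓)                 ≤⟨ +-monoʳ-≤ (Σcube w⊓) (+-mono-≤ edges-w⊔ edges-w⊓) ⟩
    Σcube w⊓ + (suc k * Σcube w⊔ + k * Σcube w⊓)     ≡⟨ solve 3 (λ m M k → m :+ ((con 1 :+ k) :* M :+ k :* m) := (con 1 :+ k) :* (M :+ m)) refl (Σcube w⊓) (Σcube w⊔) k ⟩
    suc k * (Σcube w⊔ + Σcube w⊓)                    ≡⟨ cong (suc k *_) Σcube-w ⟨
    suc k * Σcube w                                  ∎
    where
    open Compression w
    open ≤-Reasoning
    edges-w⊔ : edges w⊔ ≤ suc k * Σcube w⊔
    edges-w⊔ = edges≤VCdim*Σcube s (suc k) w⊔ (VCdim-w⊔ vc)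
    edges-w⊓ : edges w⊓ ≤ k * Σcube w⊓
    edges-w⊓ = edges≤VCdim*Σcube s k w⊓ (VCdim-w⊓ vc)

  support≤Φ : ∀ s k (w : Vec Bool s → ℕ) → VCdim≤ k w → Σcube (λ q → sign (w q)) ≤ Φ k s
  support≤Φ zero k w vc = sign≤1 (w [])
  support≤Φ (suc s) zero w vc = begin
    Σcube (λ q → sign (w q))                             ≡⟨ support-w ⟩
    Σcube (λ q → sign (w⊔ q)) + Σcube (λ q → sign (w⊓ q)) ≡⟨ cong (Σcube (λ q → sign (w⊔ q)) +_) (IsSum.sum-zero (Σcube-isSum s) (λ q → cong sign (w⊓≡0 vc q))) ⟩
    Σcube (λ q → sign (w⊔ q)) + 0                         ≤⟨ +-monoˡ-≤ 0 (support≤Φ s 0 w⊔ (VCdim-w⊔ vc)) ⟩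
    Φ 0 s + 0                                             ≡⟨ cong (_+ 0) (Φ0 s) ⟩
    1                                                     ∎
    where
    open Compression w
    open ≤-Reasoning
    Φ0 : ∀ s → Φ 0 s ≡ 1
    Φ0 zero = refl
    Φ0 (suc s) = refl
  support≤Φ (suc s) (suc k) w vc = begin
    Σcube (λ q → sign (w q))                              ≡⟨ support-w ⟩
    Σcube (λ q → sign (w⊔ q)) + Σcube (λ q → sign (w⊓ q)) ≤⟨ +-mono-≤ (support≤Φ s (suc k) w⊔ (VCdim-w⊔ vc)) (support≤Φ s k w⊓ (VCdim-w⊓ vc)) ⟩
    Φ (suc k) (suc s)                                     ∎
    where
    open Compression w
    open ≤-Reasoning

module PackingArithmetic where

  open import Data.Nat
  open import Data.Nat.Properties
  open import Data.Nat.DivMod using (_/_; _%_; m≡m%n+[m/n]*n; m%n≤n)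
  open import Relation.Binary.PropositionalEquality
  open import Data.Product using (_,_)
  open import Data.Nat.Solver using (module +-*-Solver)
  open +-*-Solver using (solve; _:+_; _:*_; _:=_; con)
  open Hypercube using (Φ)

  m≤[1+m/n]*n : ∀ m n .{{_ : NonZero n}} → m ≤ suc (m / n) * n
  m≤[1+m/n]*n m n = begin
    m                  ≡⟨ m≡m%n+[m/n]*n m n ⟩
    m % n + m / n * n  ≤⟨ +-monoˡ-≤ (m / n * n) (m%n≤n m n) ⟩
    n + m / n * n      ∎
    where open ≤-Reasoning

  ^-distribʳ-* : ∀ m n k → (m * n) ^ k ≡ m ^ k * n ^ k
  ^-distribʳ-* m n zero = refl
  ^-distribʳ-* m n (suc k) = trans (cong (m * n *_) (^-distribʳ-* m n k))
    (solve 4 (λ m n A B → m :* n :* (A :* B) := m :* A :* (n :* B)) refl m n (m ^ k) (n ^ k))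

  n!≤n^n : ∀ n → n ! ≤ n ^ n
  n!≤n^n zero = ≤-refl
  n!≤n^n (suc n) = *-monoʳ-≤ (suc n) (≤-trans (n!≤n^n n) (^-monoˡ-≤ n (n≤1+n n)))

  x^[1+j]+[1+j]*x^j≤[1+x]^[1+j] : ∀ x j → x ^ suc j + suc j * x ^ j ≤ suc x ^ suc j
  x^[1+j]+[1+j]*x^j≤[1+x]^[1+j] x zero = ≤-reflexive (solve 1 (λ x → x :* con 1 :+ con 1 :* con 1 := (con 1 :+ x) :* con 1) refl x)
  x^[1+j]+[1+j]*x^j≤[1+x]^[1+j] x (suc j) = begin
    x * (x * x^j) + (2 + j) * (x * x^j)                    ≤⟨ m≤m+n _ ((1 + j) * x^j) ⟩
    x * (x * x^j) + (2 + j) * (x * x^j) + (1 + j) * x^j    ≡⟨ solve 3 (λ x j B → x :* (x :* B) :+ (con 2 :+ j) :* (x :* B) :+ (con 1 :+ j) :* B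
                                                                          := (con 1 :+ x) :* (x :* B :+ (con 1 :+ j) :* B)) refl x j x^j ⟩
    suc x * (x ^ suc j + suc j * x ^ j)                    ≤⟨ *-monoʳ-≤ (suc x) (x^[1+j]+[1+j]*x^j≤[1+x]^[1+j] x j) ⟩
    suc x * suc x ^ suc j                                  ∎
    where
    open ≤-Reasoning
    x^j : ℕ
    x^j = x ^ j

  Φ*k!≤[n+k]^k : ∀ k n → Φ k n * k ! ≤ (n + k) ^ k
  Φ*k!≤[n+k]^k k zero = ≤-trans (≤-reflexive (+-identityʳ (k !))) (n!≤n^n k)
  Φ*k!≤[n+k]^k zero (suc n) = ≤-refl
  Φ*k!≤[n+k]^k (suc k) (suc n) = begin
    (Φ (suc k) n + Φ k n) * (suc k * k !)
      ≡⟨ solve 4 (λ P Q k f → (P :+ Q) :* ((con 1 :+ k) :* f) := P :* ((con 1 :+ k) :* f) :+ (con 1 :+ k) :* (Q :* f)) refl (Φ (suc k) n) (Φ k n) k (k !) ⟩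
    Φ (suc k) n * (suc k) ! + suc k * (Φ k n * k !)
      ≤⟨ +-mono-≤ (Φ*k!≤[n+k]^k (suc k) n) (*-monoʳ-≤ (suc k) (≤-trans (Φ*k!≤[n+k]^k k n) (^-monoˡ-≤ k n+k≤x))) ⟩
    x ^ suc k + suc k * x ^ k
      ≤⟨ x^[1+j]+[1+j]*x^j≤[1+x]^[1+j] x k ⟩
    suc x ^ suc k
      ∎
    where
    open ≤-Reasoning
    x : ℕ
    x = n + suc k
    n+k≤x : n + k ≤ x
    n+k≤x = ≤-trans (n≤1+n (n + k)) (≤-reflexive (sym (+-suc n k)))

  [1+k]*q[j]≤k*q[1+j] : ∀ k j → j ≤ k → suc k * (k * k + j * k + j * j) ≤ k * (k * k + suc j * k + suc j * suc j)
  [1+k]*q[j]≤k*q[1+j] k j j≤k with m≤n⇒∃[o]m+o≡n j≤k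
  ... | d , refl = subst (suc (j + d) * (k′ * k′ + j * k′ + j * j) ≤_) polynomial (m≤m+n _ (j + d * j + d))
    where
    k′ : ℕ
    k′ = j + d
    polynomial : suc k′ * (k′ * k′ + j * k′ + j * j) + (j + d * j + d) ≡ k′ * (k′ * k′ + suc j * k′ + suc j * suc j)
    polynomial = solve 2 (λ j d → (con 1 :+ (j :+ d)) :* ((j :+ d) :* (j :+ d) :+ j :* (j :+ d) :+ j :* j) :+ (j :+ d :* j :+ d)
                                := (j :+ d) :* ((j :+ d) :* (j :+ d) :+ (con 1 :+ j) :* (j :+ d) :+ (con 1 :+ j) :* (con 1 :+ j))) refl j d

  -- (1 + 1/k)^j ≤ 1 + j/k + (j/k)² for j ≤ k, cleared of denominators; at j = k, (1 + 1/k)^k ≤ 3.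
  [1+k]^j*k²≤k^j*[k²+jk+j²] : ∀ k j → j ≤ k → suc k ^ j * (k * k) ≤ k ^ j * (k * k + j * k + j * j)
  [1+k]^j*k²≤k^j*[k²+jk+j²] k zero _ = ≤-reflexive (solve 1 (λ k → con 1 :* (k :* k) := con 1 :* (k :* k :+ con 0 :* k :+ con 0 :* con 0)) refl k)
  [1+k]^j*k²≤k^j*[k²+jk+j²] k (suc j) 1+j≤k = begin
    suc k * suc k ^ j * (k * k)               ≡⟨ *-assoc (suc k) (suc k ^ j) (k * k) ⟩
    suc k * (suc k ^ j * (k * k))             ≤⟨ *-monoʳ-≤ (suc k) ([1+k]^j*k²≤k^j*[k²+jk+j²] k j (<⇒≤ 1+j≤k)) ⟩
    suc k * (k ^ j * q j)                     ≡⟨ solve 3 (λ k A Q → (con 1 :+ k) :* (A :* Q) := A :* ((con 1 :+ k) :* Q)) refl k (k ^ j) (q j) ⟩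
    k ^ j * (suc k * q j)                     ≤⟨ *-monoʳ-≤ (k ^ j) ([1+k]*q[j]≤k*q[1+j] k j (<⇒≤ 1+j≤k)) ⟩
    k ^ j * (k * q (suc j))                   ≡⟨ *-assoc (k ^ j) k _ ⟨
    k ^ j * k * q (suc j)                     ≡⟨ cong (_* q (suc j)) (*-comm (k ^ j) k) ⟩
    k * k ^ j * q (suc j)                     ∎
    where
    open ≤-Reasoning
    q : ℕ → ℕ
    q i = k * k + i * k + i * i

  [1+k]^k≤3*k^k : ∀ k → suc k ^ k ≤ 3 * k ^ k
  [1+k]^k≤3*k^k zero = s≤s z≤n
  [1+k]^k≤3*k^k k@(suc _) = *-cancelʳ-≤ (suc k ^ k) (3 * k ^ k) (k * k) (begin
    suc k ^ k * (k * k)                 ≤⟨ [1+k]^j*k²≤k^j*[k²+jk+j²] k k ≤-refl ⟩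
    k ^ k * (k * k + k * k + k * k)     ≡⟨ solve 2 (λ A K → A :* (K :+ K :+ K) := con 3 :* A :* K) refl (k ^ k) (k * k) ⟩
    3 * k ^ k * (k * k)                 ∎)
    where open ≤-Reasoning

  [1+k]^[1+k]≤3^k*[1+k]! : ∀ k → suc k ^ suc k ≤ 3 ^ k * suc k !
  [1+k]^[1+k]≤3^k*[1+k]! zero = ≤-refl
  [1+k]^[1+k]≤3^k*[1+k]! (suc k) = begin
    (2 + k) * (2 + k) ^ suc k                 ≤⟨ *-monoʳ-≤ (2 + k) ([1+k]^k≤3*k^k (suc k)) ⟩
    (2 + k) * (3 * (1 + k) ^ suc k)           ≤⟨ *-monoʳ-≤ (2 + k) (*-monoʳ-≤ 3 ([1+k]^[1+k]≤3^k*[1+k]! k)) ⟩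
    (2 + k) * (3 * (3 ^ k * suc k !))         ≡⟨ solve 3 (λ k P F → (con 2 :+ k) :* (con 3 :* (P :* F)) := con 3 :* P :* ((con 2 :+ k) :* F)) refl k (3 ^ k) (suc k !) ⟩
    3 ^ suc k * suc (suc k) !                 ∎
    where open ≤-Reasoning

  -- With s ≈ 4kb/a: Φ k s ≤ (s + k)^k / k! ≤ (5kb/a)^k / k! and k^k / k! ≤ 3^(k-1).
  packing-arithmetic : ∀ k m a b s → m ≤ 2 * Φ (suc k) s → s * a ≤ 4 * suc k * b → a ≤ b →
    m * a ^ suc k ≤ (30 * b) ^ suc k
  packing-arithmetic k′ m a b s m≤2Φ sa≤4kb a≤b = *-cancelʳ-≤ (m * a ^ k) ((30 * b) ^ k) (k !) {{k !≢0}} (begin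
    m * a ^ k * k !                   ≤⟨ *-monoˡ-≤ (k !) (*-monoˡ-≤ (a ^ k) m≤2Φ) ⟩
    2 * Φ k s * a ^ k * k !           ≡⟨ solve 3 (λ P A F → con 2 :* P :* A :* F := con 2 :* (P :* F) :* A) refl (Φ k s) (a ^ k) (k !) ⟩
    2 * (Φ k s * k !) * a ^ k         ≤⟨ *-monoˡ-≤ (a ^ k) (*-monoʳ-≤ 2 (Φ*k!≤[n+k]^k k s)) ⟩
    2 * (s + k) ^ k * a ^ k           ≡⟨ trans (*-assoc 2 ((s + k) ^ k) (a ^ k)) (cong (2 *_) (sym (^-distribʳ-* (s + k) a k))) ⟩
    2 * ((s + k) * a) ^ k             ≤⟨ *-monoʳ-≤ 2 (^-monoˡ-≤ k [s+k]a≤k*5b) ⟩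
    2 * (k * (5 * b)) ^ k             ≡⟨ cong (2 *_) (^-distribʳ-* k (5 * b) k) ⟩
    2 * (k ^ k * (5 * b) ^ k)         ≤⟨ *-monoʳ-≤ 2 (*-monoˡ-≤ ((5 * b) ^ k) ([1+k]^[1+k]≤3^k*[1+k]! k′)) ⟩
    2 * (3 ^ k′ * k ! * (5 * b) ^ k)  ≡⟨ solve 3 (λ P F Q → con 2 :* (P :* F :* Q) := con 2 :* P :* Q :* F) refl (3 ^ k′) (k !) ((5 * b) ^ k) ⟩
    2 * 3 ^ k′ * (5 * b) ^ k * k !    ≤⟨ *-monoˡ-≤ (k !) (*-monoˡ-≤ ((5 * b) ^ k) 2*3^k′≤6^k) ⟩
    6 ^ k * (5 * b) ^ k * k !         ≡⟨ cong (_* k !) (^-distribʳ-* 6 (5 * b) k) ⟨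
    (6 * (5 * b)) ^ k * k !           ≡⟨ cong (λ t → t ^ k * k !) (*-assoc 6 5 b) ⟨
    (30 * b) ^ k * k !                ∎)
    where
    open ≤-Reasoning
    k : ℕ
    k = suc k′
    [s+k]a≤k*5b : (s + k) * a ≤ k * (5 * b)
    [s+k]a≤k*5b = begin
      (s + k) * a        ≡⟨ *-distribʳ-+ a s k ⟩
      s * a + k * a      ≤⟨ +-mono-≤ sa≤4kb (*-monoʳ-≤ k a≤b) ⟩
      4 * k * b + k * b  ≡⟨ solve 2 (λ k b → con 4 :* k :* b :+ k :* b := k :* (con 5 :* b)) refl k b ⟩
      k * (5 * b)        ∎
    2*3^k′≤6^k : 2 * 3 ^ k′ ≤ 6 ^ k
    2*3^k′≤6^k = *-mono-≤ {2} {6} (s≤s (s≤s z≤n)) (^-monoˡ-≤ k′ {3} {6} (s≤s (s≤s (s≤s z≤n))))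

  2[m∸n]≤m⇒m≤2n : ∀ m n → 2 * (m ∸ n) ≤ m → m ≤ 2 * n
  2[m∸n]≤m⇒m≤2n m n 2[m∸n]≤m = begin
    m                ≤⟨ m≤n+m∸n m n ⟩
    n + (m ∸ n)      ≤⟨ +-monoʳ-≤ n m∸n≤n ⟩
    n + n            ≡⟨ cong (n +_) (+-identityʳ n) ⟨
    2 * n            ∎
    where
    open ≤-Reasoning
    m∸n≤n : m ∸ n ≤ n
    m∸n≤n = +-cancelʳ-≤ (m ∸ n) (m ∸ n) n (begin
      m ∸ n + (m ∸ n)      ≡⟨ cong (m ∸ n +_) (+-identityʳ (m ∸ n)) ⟨
      2 * (m ∸ n)          ≤⟨ 2[m∸n]≤m ⟩
      m                    ≤⟨ m≤n+m∸n m n ⟩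
      n + (m ∸ n)          ∎)

module Packing {X : Set} (xs : List X) where

  open import Data.Nat
  open import Data.Nat.Properties
  open import Data.Nat.DivMod using (_/_; m/n*n≤m)
  open import Data.Nat.Solver using (module +-*-Solver)
  open +-*-Solver using (solve; _:+_; _:*_; _:=_; con)
  open import Data.Bool using (Bool; true; false; not; _xor_)
  open import Data.Bool.Properties using () renaming (_≟_ to _≟ᵇ_)
  open import Data.List using (List; []; _∷_; length; filter)
  open import Data.List.Membership.Propositional using (_∈_)
  open import Data.List.Membership.Propositional.Properties using (∈-filter⁻)
  open import Data.List.Relation.Unary.Any using (here)
  open import Data.List.Relation.Unary.All as All using (All; []; _∷_)
  open import Data.List.Relation.Unary.AllPairs using (AllPairs; []; _∷_)
  open import Data.List.Relation.Unary.AllPairs.Properties using (filter⁺)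
  open import Data.Vec using (Vec; []; _∷_; lookup)
  open import Data.Fin using (Fin; zero; suc)
  open import Data.Product using (Σ; _×_; _,_)
  open import Data.Sum using (inj₁; inj₂)
  open import Relation.Nullary using (does)
  open import Relation.Unary using (Decidable)
  open import Relation.Binary.PropositionalEquality
  open FiniteSums
  open Tuples xs
  open Hypercube
  open PackingArithmetic

  N : ℕ
  N = length xs

  Family : Set
  Family = List (X → Bool)

  restrict : X → Bool → Family → Family
  restrict x b = filter (λ F → F x ≟ᵇ b)

  cell : ∀ {s} → Family → Vec X s → Vec Bool s → Family
  cell Fs [] [] = Fs
  cell Fs (x ∷ I) (b ∷ q) = cell (restrict x b Fs) I q

  multiplicity : ∀ {s} → Family → Vec X s → Vec Bool s → ℕ
  multiplicity Fs I q = length (cell Fs I q)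

  FamilyVCdim≤ : ℕ → Family → Set
  FamilyVCdim≤ k Fs = ∀ d (x : Fin d → X) →
    ((S : Fin d → Bool) → Σ (X → Bool) λ F → F ∈ Fs × (∀ i → F (x i) ≡ S i)) → d ≤ k

  dist : (X → Bool) → (X → Bool) → ℕ
  dist F G = Σlist xs (λ x → 𝟙 (F x xor G x))

  length-restrict-false : ∀ x Fs → length (restrict x false Fs) ≡ Σlist Fs (λ F → 𝟙 (not (F x)))
  length-restrict-false x Fs =
    trans (length-filter≡Σlist _ Fs) (IsSum.sum-cong (Σlist-isSum Fs) (λ F → 𝟙-≟false (F x)))
    where
    𝟙-≟false : ∀ u → 𝟙 (does (u ≟ᵇ false)) ≡ 𝟙 (not u)
    𝟙-≟false false = refl
    𝟙-≟false true = refl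

  length-restrict-true : ∀ x Fs → length (restrict x true Fs) ≡ Σlist Fs (λ F → 𝟙 (F x))
  length-restrict-true x Fs =
    trans (length-filter≡Σlist _ Fs) (IsSum.sum-cong (Σlist-isSum Fs) (λ F → 𝟙-≟true (F x)))
    where
    𝟙-≟true : ∀ u → 𝟙 (does (u ≟ᵇ true)) ≡ 𝟙 u
    𝟙-≟true false = refl
    𝟙-≟true true = refl

  length-restrict : ∀ x Fs → length (restrict x false Fs) + length (restrict x true Fs) ≡ length Fs
  length-restrict x Fs = begin
    length (restrict x false Fs) + length (restrict x true Fs)  ≡⟨ cong₂ _+_ (length-restrict-false x Fs) (length-restrict-true x Fs) ⟩
    Σlist Fs (λ F → 𝟙 (not (F x))) + Σlist Fs (λ F → 𝟙 (F x))   ≡⟨ sum-+ _ _ ⟨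
    Σlist Fs (λ F → 𝟙 (not (F x)) + 𝟙 (F x))                    ≡⟨ sum-cong (λ F → 𝟙-not+𝟙 (F x)) ⟩
    Σlist Fs (λ F → 1)                                           ≡⟨ Σlist-const Fs 1 ⟩
    length Fs * 1                                                ≡⟨ *-identityʳ _ ⟩
    length Fs                                                    ∎
    where
    open ≡-Reasoning
    open IsSum (Σlist-isSum Fs)
    𝟙-not+𝟙 : ∀ u → 𝟙 (not u) + 𝟙 u ≡ 1
    𝟙-not+𝟙 false = refl
    𝟙-not+𝟙 true = refl

  Σcube-multiplicity : ∀ {s} (Fs : Family) (I : Vec X s) → Σcube (multiplicity Fs I) ≡ length Fs
  Σcube-multiplicity Fs [] = refl
  Σcube-multiplicity Fs (x ∷ I) =
    trans (cong₂ _+_ (Σcube-multiplicity (restrict x false Fs) I) (Σcube-multiplicity (restrict x true Fs) I))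
          (length-restrict x Fs)

  filter-comm : ∀ {A : Set} {P Q : A → Set} (P? : Decidable P) (Q? : Decidable Q) (l : List A) →
    filter P? (filter Q? l) ≡ filter Q? (filter P? l)
  filter-comm P? Q? [] = refl
  filter-comm P? Q? (z ∷ l) with does (P? z) in eP | does (Q? z) in eQ
  ... | true | true rewrite eP | eQ = cong (z ∷_) (filter-comm P? Q? l)
  ... | true | false rewrite eQ = filter-comm P? Q? l
  ... | false | true rewrite eP = filter-comm P? Q? l
  ... | false | false = filter-comm P? Q? l

  cell-restrict : ∀ {s} (Fs : Family) x c (I : Vec X s) (q : Vec Bool s) →
    cell (restrict x c Fs) I q ≡ restrict x c (cell Fs I q)
  cell-restrict Fs x c [] [] = refl
  cell-restrict Fs x c (y ∷ I) (b ∷ q) =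
    trans (cong (λ Gs → cell Gs I q) (filter-comm _ _ Fs)) (cell-restrict (restrict y b Fs) x c I q)

  ∈-cell : ∀ {s} {Fs : Family} (I : Vec X s) (q : Vec Bool s) {F} → F ∈ cell Fs I q →
    F ∈ Fs × (∀ i → F (lookup I i) ≡ lookup q i)
  ∈-cell [] [] F∈ = F∈ , λ ()
  ∈-cell {Fs = Fs} (x ∷ I) (b ∷ q) {F} F∈ with ∈-cell I q F∈
  ... | F∈restrict , F|I≡q with ∈-filter⁻ (λ F → F x ≟ᵇ b) {xs = Fs} F∈restrict
  ...   | F∈Fs , Fx≡b = F∈Fs , F|xI≡bq
    where
    F|xI≡bq : ∀ i → F (lookup (x ∷ I) i) ≡ lookup (b ∷ q) i
    F|xI≡bq zero = Fx≡b
    F|xI≡bq (suc i) = F|I≡q i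

  VCdim-multiplicity : ∀ {s} k Fs (I : Vec X s) → FamilyVCdim≤ k Fs → VCdim≤ k (multiplicity Fs I)
  VCdim-multiplicity k Fs I vc d J shatters = vc d (λ i → lookup I (J i)) shattered
    where
    shattered : (S : Fin d → Bool) → Σ (X → Bool) λ F → F ∈ Fs × (∀ i → F (lookup I (J i)) ≡ S i)
    shattered S with shatters S
    ... | q , 0<mult , q|J≡S with cell Fs I q | ∈-cell {Fs = Fs} I q
    ...   | F ∷ _ | ∈-cell′ with ∈-cell′ (here refl)
    ...     | F∈Fs , F|I≡q = F , F∈Fs , λ i → trans (F|I≡q (J i)) (q|J≡S i)

  dist⁺ : (X → Bool) → (X → Bool) → ℕ
  dist⁺ F G = Σlist xs (λ x → 𝟙 (not (F x)) * 𝟙 (G x))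

  dist≡dist⁺+dist⁺ : ∀ F G → dist F G ≡ dist⁺ F G + dist⁺ G F
  dist≡dist⁺+dist⁺ F G = trans (sum-cong (λ x → 𝟙-xor (F x) (G x))) (sum-+ _ _)
    where
    open IsSum (Σlist-isSum xs)
    𝟙-xor : ∀ u v → 𝟙 (u xor v) ≡ 𝟙 (not u) * 𝟙 v + 𝟙 (not v) * 𝟙 u
    𝟙-xor false false = refl
    𝟙-xor false true = refl
    𝟙-xor true false = refl
    𝟙-xor true true = refl

  dist-self : ∀ F → dist F F ≡ 0
  dist-self F = IsSum.sum-zero (Σlist-isSum xs) (λ x → 𝟙-xor-self (F x))
    where
    𝟙-xor-self : ∀ u → 𝟙 (u xor u) ≡ 0
    𝟙-xor-self false = refl
    𝟙-xor-self true = refl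

  dist-sym : ∀ F G → dist F G ≡ dist G F
  dist-sym F G = trans (dist≡dist⁺+dist⁺ F G) (trans (+-comm (dist⁺ F G) _) (sym (dist≡dist⁺+dist⁺ G F)))

  Σ²dist⁺ : ∀ (C : Family) →
    Σlist C (λ F → Σlist C (λ G → dist⁺ F G)) ≡ Σlist xs (λ x → length (restrict x false C) * length (restrict x true C))
  Σ²dist⁺ C = begin
    Σlist C (λ F → Σlist C (λ G → Σlist xs (λ x → 𝟙 (not (F x)) * 𝟙 (G x))))
      ≡⟨ IsSum.sum-cong (Σlist-isSum C) (λ F → Σlist-swap (Σlist-isSum xs) C _) ⟩
    Σlist C (λ F → Σlist xs (λ x → Σlist C (λ G → 𝟙 (not (F x)) * 𝟙 (G x))))
      ≡⟨ Σlist-swap (Σlist-isSum xs) C _ ⟩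
    Σlist xs (λ x → Σlist C (λ F → Σlist C (λ G → 𝟙 (not (F x)) * 𝟙 (G x))))
      ≡⟨ IsSum.sum-cong (Σlist-isSum xs) (λ x → Σlist-* C C _ _) ⟨
    Σlist xs (λ x → Σlist C (λ F → 𝟙 (not (F x))) * Σlist C (λ G → 𝟙 (G x)))
      ≡⟨ IsSum.sum-cong (Σlist-isSum xs) (λ x → cong₂ _*_ (length-restrict-false x C) (length-restrict-true x C)) ⟨
    Σlist xs (λ x → length (restrict x false C) * length (restrict x true C))
      ∎
    where open ≡-Reasoning

  Σ²dist : ∀ (C : Family) →
    Σlist C (λ F → Σlist C (λ G → dist F G)) ≡ 2 * Σlist xs (λ x → length (restrict x false C) * length (restrict x true C))
  Σ²dist C = begin
    Σlist C (λ F → Σlist C (λ G → dist F G))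
      ≡⟨ sum-cong (λ F → trans (sum-cong (λ G → dist≡dist⁺+dist⁺ F G)) (sum-+ _ _)) ⟩
    Σlist C (λ F → Σlist C (λ G → dist⁺ F G) + Σlist C (λ G → dist⁺ G F))
      ≡⟨ sum-+ _ _ ⟩
    Σ²⁺ + Σlist C (λ F → Σlist C (λ G → dist⁺ G F))
      ≡⟨ cong (Σ²⁺ +_) (Σlist-swap (Σlist-isSum C) C (λ F G → dist⁺ G F)) ⟩
    Σ²⁺ + Σ²⁺
      ≡⟨ cong (Σ²⁺ +_) (+-identityʳ Σ²⁺) ⟨
    2 * Σ²⁺
      ≡⟨ cong (2 *_) (Σ²dist⁺ C) ⟩
    2 * Σlist xs (λ x → length (restrict x false C) * length (restrict x true C))
      ∎
    where
    open ≡-Reasoning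
    open IsSum (Σlist-isSum C)
    Σ²⁺ : ℕ
    Σ²⁺ = Σlist C (λ F → Σlist C (λ G → dist⁺ F G))

  AllPairs⇒Σ²≥ : ∀ {A : Set} (d : A → A → ℕ) → (∀ a b → d a b ≡ d b a) → ∀ K (C : List A) →
    AllPairs (λ a b → K ≤ d a b) C → length C * (length C ∸ 1) * K ≤ Σlist C (λ a → Σlist C (d a))
  AllPairs⇒Σ²≥ d d-sym K [] [] = z≤n
  AllPairs⇒Σ²≥ d d-sym K (a ∷ C) (K≤d[a,-] ∷ K≤d-on-C) = begin
    suc c * c * K                              ≡⟨ arrange c ⟩
    c * K + (c * K + c * (c ∸ 1) * K)          ≤⟨ +-mono-≤ (All⇒length*≤Σlist C K≤d[a,-])
                                                   (+-mono-≤ (All⇒length*≤Σlist C K≤d[-,a]) (AllPairs⇒Σ²≥ d d-sym K C K≤d-on-C)) ⟩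
    row + (column + Σlist C (λ b → Σlist C (d b)))
                                               ≤⟨ +-mono-≤ (m≤n+m row (d a a)) (≤-reflexive (sym (sum-+ (λ b → d b a) _))) ⟩
    (d a a + row) + Σlist C (λ b → d b a + Σlist C (d b))
                                               ∎
    where
    open ≤-Reasoning
    open IsSum (Σlist-isSum C)
    c row column : ℕ
    c = length C
    row = Σlist C (d a)
    column = Σlist C (λ b → d b a)
    K≤d[-,a] : All (λ b → K ≤ d b a) C
    K≤d[-,a] = All.map (λ {b} K≤dab → subst (K ≤_) (d-sym a b) K≤dab) K≤d[a,-]
    arrange : ∀ c → suc c * c * K ≡ c * K + (c * K + c * (c ∸ 1) * K)
    arrange zero = refl
    arrange (suc c) = solve 2 (λ c K → (con 2 :+ c) :* (con 1 :+ c) :* K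
                                       := (con 1 :+ c) :* K :+ ((con 1 :+ c) :* K :+ (con 1 :+ c) :* c :* K)) refl c K

  m*n≤[m+n]*[m⊓n] : ∀ m n → m * n ≤ (m + n) * (m ⊓ n)
  m*n≤[m+n]*[m⊓n] m n with ≤-total m n
  ... | inj₁ m≤n rewrite m≤n⇒m⊓n≡m m≤n = subst (_≤ (m + n) * m) (*-comm n m) (*-monoˡ-≤ m (m≤n+m n m))
  ... | inj₂ n≤m rewrite m≥n⇒m⊓n≡n n≤m = *-monoˡ-≤ n (m≤m+n m n)

  surplus : ∀ {s} → Family → Vec X s → ℕ
  surplus Fs I = Σcube (λ q → multiplicity Fs I q ∸ 1)

  length∸Φ≤surplus : ∀ {s} k Fs (I : Vec X s) → FamilyVCdim≤ k Fs → length Fs ∸ Φ k s ≤ surplus Fs I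
  length∸Φ≤surplus {s} k Fs I vc = begin
    length Fs ∸ Φ k s                 ≤⟨ ∸-monoʳ-≤ (length Fs) (support≤Φ s k (multiplicity Fs I) (VCdim-multiplicity k Fs I vc)) ⟩
    length Fs ∸ support               ≡⟨ cong (_∸ support) surplus+support ⟨
    surplus Fs I + support ∸ support  ≡⟨ m+n∸n≡m (surplus Fs I) support ⟩
    surplus Fs I                      ∎
    where
    open ≤-Reasoning
    open IsSum (Σcube-isSum s)
    support : ℕ
    support = Σcube (λ q → sign (multiplicity Fs I q))
    [m∸1]+sign-m≡m : ∀ m → (m ∸ 1) + sign m ≡ m
    [m∸1]+sign-m≡m zero = refl
    [m∸1]+sign-m≡m (suc m) = +-comm m 1
    surplus+support : surplus Fs I + support ≡ length Fs
    surplus+support = trans (sym (sum-+ _ _))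
      (trans (sum-cong (λ q → [m∸1]+sign-m≡m (multiplicity Fs I q))) (Σcube-multiplicity Fs I))

  module Separation (b K : ℕ) where

    Separated : Family → Set
    Separated = AllPairs (λ F G → K ≤ b * dist F G)

    -- A point x splitting C into n₀ + n₁ members separates n₀ n₁ ≤ |C| (n₀ ⊓ n₁) of its pairs.
    separated-splitting : ∀ (C : Family) → Separated C →
      K * (length C ∸ 1) ≤ 2 * b * Σlist xs (λ x → length (restrict x false C) ⊓ length (restrict x true C))
    separated-splitting [] [] = ≤-trans (≤-reflexive (*-zeroʳ K)) z≤n
    separated-splitting C@(_ ∷ _) sep = *-cancelˡ-≤ (length C) (begin
      c * (K * (c ∸ 1))                                 ≡⟨ solve 3 (λ c K d → c :* (K :* d) := c :* d :* K) refl c K (c ∸ 1) ⟩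
      c * (c ∸ 1) * K                                   ≤⟨ AllPairs⇒Σ²≥ (λ F G → b * dist F G) (λ F G → cong (b *_) (dist-sym F G)) K C sep ⟩
      Σlist C (λ F → Σlist C (λ G → b * dist F G))      ≡⟨ trans (*-sum b _) (sum-cong (λ F → IsSum.*-sum (Σlist-isSum C) b _)) ⟨
      b * Σlist C (λ F → Σlist C (λ G → dist F G))      ≡⟨ cong (b *_) (Σ²dist C) ⟩
      b * (2 * Σlist xs (λ x → n₀ x * n₁ x))            ≤⟨ *-monoʳ-≤ b (*-monoʳ-≤ 2 (IsSum.sum-mono-≤ (Σlist-isSum xs) n₀n₁≤c[n₀⊓n₁])) ⟩
      b * (2 * Σlist xs (λ x → c * (n₀ x ⊓ n₁ x)))      ≡⟨ cong (λ t → b * (2 * t)) (IsSum.*-sum (Σlist-isSum xs) c _) ⟨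
      b * (2 * (c * Σlist xs (λ x → n₀ x ⊓ n₁ x)))      ≡⟨ solve 3 (λ b c t → b :* (con 2 :* (c :* t)) := c :* (con 2 :* b :* t)) refl b c _ ⟩
      c * (2 * b * Σlist xs (λ x → n₀ x ⊓ n₁ x))        ∎)
      where
      open ≤-Reasoning
      open IsSum (Σlist-isSum C)
      c : ℕ
      c = length C
      n₀ n₁ : X → ℕ
      n₀ x = length (restrict x false C)
      n₁ x = length (restrict x true C)
      n₀n₁≤c[n₀⊓n₁] : ∀ x → n₀ x * n₁ x ≤ c * (n₀ x ⊓ n₁ x)
      n₀n₁≤c[n₀⊓n₁] x = subst (λ t → n₀ x * n₁ x ≤ t * (n₀ x ⊓ n₁ x)) (length-restrict x C) (m*n≤[m+n]*[m⊓n] (n₀ x) (n₁ x))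

    Separated-restrict : ∀ x c Fs → Separated Fs → Separated (restrict x c Fs)
    Separated-restrict x c Fs = filter⁺ (λ F → F x ≟ᵇ c)

    Separated-cell : ∀ {s} Fs (I : Vec X s) q → Separated Fs → Separated (cell Fs I q)
    Separated-cell Fs [] [] sep = sep
    Separated-cell Fs (x ∷ I) (c ∷ q) sep = Separated-cell (restrict x c Fs) I q (Separated-restrict x c Fs sep)

    separated-splitting-cell : ∀ {s} Fs (I : Vec X s) q → Separated Fs →
      K * (multiplicity Fs I q ∸ 1) ≤ 2 * b * Σlist xs (λ x → multiplicity Fs (x ∷ I) (false ∷ q) ⊓ multiplicity Fs (x ∷ I) (true ∷ q))
    separated-splitting-cell Fs I q sep = subst (λ t → K * (multiplicity Fs I q ∸ 1) ≤ 2 * b * t)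
      (IsSum.sum-cong (Σlist-isSum xs) (λ x → sym (cong₂ (λ C₀ C₁ → length C₀ ⊓ length C₁) (cell-restrict Fs x false I q) (cell-restrict Fs x true I q))))
      (separated-splitting (cell Fs I q) (Separated-cell Fs I q sep))

    -- The j-th point of a sample of size s + 1 is a fresh point for the sample of the other s points:
    -- on each cell of the latter, separated-splitting bounds the edges in direction j.
    surplus≤edges-along : ∀ {s} (j : Fin (suc s)) (Fs : Family) → Separated Fs →
      K * Σtuple {s} (surplus Fs) ≤ 2 * b * Σtuple {suc s} (λ I → edges-along j (multiplicity Fs I))
    surplus≤edges-along {s} zero Fs sep = begin
      K * Σtuple {s} (λ I → Σcube (λ q → multiplicity Fs I q ∸ 1))
        ≤⟨ IsSum.*-sum-mono-≤ (Σtuple-isSum s) K (2 * b) (λ I → IsSum.*-sum-mono-≤ (Σcube-isSum s) K (2 * b) (λ q → separated-splitting-cell Fs I q sep)) ⟩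
      2 * b * Σtuple (λ I → Σcube (λ q → Σlist xs (λ x → e x I q)))
        ≡⟨ cong (2 * b *_) (IsSum.sum-cong (Σtuple-isSum s) (λ I → Σlist-swap (Σcube-isSum s) xs (λ x q → e x I q))) ⟨
      2 * b * Σtuple (λ I → Σlist xs (λ x → Σcube (e x I)))
        ≡⟨ cong (2 * b *_) (Σlist-swap (Σtuple-isSum s) xs (λ x I → Σcube (e x I))) ⟨
      2 * b * Σlist xs (λ x → Σtuple (λ I → Σcube (e x I)))
        ∎
      where
      open ≤-Reasoning
      e : X → Vec X s → Vec Bool s → ℕ
      e x I q = multiplicity Fs (x ∷ I) (false ∷ q) ⊓ multiplicity Fs (x ∷ I) (true ∷ q)
    surplus≤edges-along {suc s} (suc j) Fs sep =
      IsSum.*-sum-mono-≤ (Σlist-isSum xs) K (2 * b) λ x → begin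
        K * Σtuple {s} (λ I → surplus (Fs₀ x) I + surplus (Fs₁ x) I)
          ≡⟨ trans (cong (K *_) (IsSum.sum-+ (Σtuple-isSum s) (surplus (Fs₀ x)) (surplus (Fs₁ x)))) (*-distribˡ-+ K _ _) ⟩
        K * Σtuple {s} (surplus (Fs₀ x)) + K * Σtuple {s} (surplus (Fs₁ x))
          ≤⟨ +-mono-≤ (surplus≤edges-along j (Fs₀ x) (Separated-restrict x false Fs sep))
                      (surplus≤edges-along j (Fs₁ x) (Separated-restrict x true Fs sep)) ⟩
        2 * b * Σtuple (E (Fs₀ x)) + 2 * b * Σtuple (E (Fs₁ x))
          ≡⟨ trans (cong (2 * b *_) (IsSum.sum-+ (Σtuple-isSum (suc s)) (E (Fs₀ x)) (E (Fs₁ x)))) (*-distribˡ-+ (2 * b) _ _) ⟨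
        2 * b * Σtuple (λ I → E (Fs₀ x) I + E (Fs₁ x) I)
          ∎
      where
      open ≤-Reasoning
      Fs₀ Fs₁ : X → Family
      Fs₀ x = restrict x false Fs
      Fs₁ x = restrict x true Fs
      E : Family → Vec X (suc s) → ℕ
      E Gs I = edges-along j (multiplicity Gs I)

    double-count : ∀ s k Fs → Separated Fs → FamilyVCdim≤ k Fs →
      suc s * (K * (N ^ s * (length Fs ∸ Φ k s))) ≤ 2 * b * (N ^ suc s * (k * length Fs))
    double-count s k Fs sep vc = begin
      suc s * (K * (N ^ s * (length Fs ∸ Φ k s)))
        ≡⟨ cong (λ t → suc s * (K * t)) (Σtuple-const s _) ⟨
      suc s * (K * Σtuple {s} (λ _ → length Fs ∸ Φ k s))
        ≤⟨ *-monoʳ-≤ (suc s) (*-monoʳ-≤ K (IsSum.sum-mono-≤ (Σtuple-isSum s) (λ I → length∸Φ≤surplus k Fs I vc))) ⟩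
      suc s * (K * Σtuple {s} (surplus Fs))
        ≡⟨ Σfin-const (suc s) _ ⟨
      Σfin {suc s} (λ j → K * Σtuple {s} (surplus Fs))
        ≤⟨ IsSum.sum-mono-≤ (Σfin-isSum (suc s)) (λ j → surplus≤edges-along j Fs sep) ⟩
      Σfin {suc s} (λ j → 2 * b * Σtuple {suc s} (λ I → edges-along j (multiplicity Fs I)))
        ≡⟨ IsSum.*-sum (Σfin-isSum (suc s)) (2 * b) (λ j → Σtuple {suc s} (λ I → edges-along j (multiplicity Fs I))) ⟨
      2 * b * Σfin {suc s} (λ j → Σtuple {suc s} (λ I → edges-along j (multiplicity Fs I)))
        ≡⟨ cong (2 * b *_) (Σfin-swap (Σtuple-isSum (suc s)) (suc s) (λ j I → edges-along j (multiplicity Fs I))) ⟩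
      2 * b * Σtuple {suc s} (λ I → edges (multiplicity Fs I))
        ≤⟨ *-monoʳ-≤ (2 * b) (IsSum.sum-mono-≤ (Σtuple-isSum (suc s)) edges≤k*length) ⟩
      2 * b * Σtuple {suc s} (λ _ → k * length Fs)
        ≡⟨ cong (2 * b *_) (Σtuple-const (suc s) _) ⟩
      2 * b * (N ^ suc s * (k * length Fs))
        ∎
      where
      open ≤-Reasoning
      edges≤k*length : ∀ I → edges (multiplicity Fs I) ≤ k * length Fs
      edges≤k*length I = subst (λ t → edges (multiplicity Fs I) ≤ k * t) (Σcube-multiplicity Fs I)
        (edges≤VCdim*Σcube (suc s) k (multiplicity Fs I) (VCdim-multiplicity k Fs I vc))

  open Separation using (Separated)

  size-bound : ∀ a b s k Fs .{{_ : NonZero N}} → Separated b (a * N) Fs → FamilyVCdim≤ k Fs →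
    suc s * a * (length Fs ∸ Φ k s) ≤ 2 * b * k * length Fs
  size-bound a b s k Fs sep vc = *-cancelʳ-≤ _ _ (N ^ suc s) {{m^n≢0 N (suc s)}}
    (subst₂ _≤_ (solve 5 (λ S A n P E → S :* (A :* n :* (P :* E)) := S :* A :* E :* (n :* P)) refl (suc s) a N (N ^ s) (length Fs ∸ Φ k s))
                (solve 5 (λ B n P K M → con 2 :* B :* (n :* P :* (K :* M)) := con 2 :* B :* K :* M :* (n :* P)) refl b N (N ^ s) k (length Fs))
                (Separation.double-count b (a * N) s k Fs sep vc))

  length≤1 : ∀ a b Fs .{{_ : NonZero N}} .{{_ : NonZero a}} → Separated b (a * N) Fs → FamilyVCdim≤ 0 Fs →
    length Fs ≤ 1
  length≤1 a b Fs sep vc = ≤-trans (m≤n+m∸n (length Fs) 1) (+-monoʳ-≤ 1 (≤-trans (m≤n*m (length Fs ∸ 1) a) a[m∸1]≤0))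
    where
    a[m∸1]≤0 : a * (length Fs ∸ 1) ≤ 0
    a[m∸1]≤0 = subst₂ _≤_ (cong (_* (length Fs ∸ 1)) (+-identityʳ a)) (cong (_* length Fs) (*-zeroʳ (2 * b)))
                 (size-bound a b 0 0 Fs sep vc)

  length≤2Φ : ∀ a b k s Fs .{{_ : NonZero N}} .{{_ : NonZero k}} .{{_ : NonZero b}} → 4 * k * b ≤ suc s * a →
    Separated b (a * N) Fs → FamilyVCdim≤ k Fs → length Fs ≤ 2 * Φ k s
  length≤2Φ a b k s Fs 4kb≤[1+s]a sep vc =
    2[m∸n]≤m⇒m≤2n (length Fs) (Φ k s) (*-cancelˡ-≤ (2 * k * b) {{m*n≢0 (2 * k) b {{m*n≢0 2 k}}}} (begin
      2 * k * b * (2 * excess)   ≡⟨ solve 3 (λ k b e → con 2 :* k :* b :* (con 2 :* e) := con 4 :* k :* b :* e) refl k b excess ⟩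
      4 * k * b * excess         ≤⟨ *-monoˡ-≤ excess 4kb≤[1+s]a ⟩
      suc s * a * excess         ≤⟨ size-bound a b s k Fs sep vc ⟩
      2 * b * k * length Fs      ≡⟨ cong (_* length Fs) (solve 2 (λ k b → con 2 :* b :* k := con 2 :* k :* b) refl k b) ⟩
      2 * k * b * length Fs      ∎))
    where
    open ≤-Reasoning
    excess : ℕ
    excess = length Fs ∸ Φ k s

  packing : ∀ a b k Fs → 1 ≤ a → a ≤ b → 1 ≤ N → Separated b (a * N) Fs → FamilyVCdim≤ k Fs →
    length Fs * a ^ k ≤ (30 * b) ^ k
  packing a b zero Fs 1≤a a≤b 1≤N sep vc =
    ≤-trans (≤-reflexive (*-identityʳ (length Fs))) (length≤1 a b Fs {{>-nonZero 1≤N}} {{>-nonZero 1≤a}} sep vc)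
  packing a b k@(suc k′) Fs 1≤a a≤b 1≤N sep vc =
    packing-arithmetic k′ (length Fs) a b s
      (length≤2Φ a b k s Fs {{>-nonZero 1≤N}} {{_}} {{>-nonZero (≤-trans 1≤a a≤b)}} (m≤[1+m/n]*n (4 * k * b) a) sep vc)
      (m/n*n≤m (4 * k * b) a) a≤b
    where
    instance
      a≢0 : NonZero a
      a≢0 = >-nonZero 1≤a
    s : ℕ
    s = 4 * k * b / a

module VectorSpace where

  open import Defs
  open import Data.Nat
  open import Data.Nat.Properties
  open import Data.Nat.DivMod
  open import Data.Fin using (Fin; toℕ; zero; suc)
  open import Data.Fin.Properties using (toℕ-injective; toℕ<n; toℕ-fromℕ<)
  open import Data.Fin.Permutation using (permutation)
  open import Data.Vec using ([]; _∷_)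
  open import Data.List using (List; []; _∷_; allFin; tabulate; length)
  open import Data.List.Properties using (length-tabulate)
  open import Relation.Binary.PropositionalEquality
  open FiniteSums
  open import Algebra.Properties.CommutativeMonoid.Sum +-0-commutativeMonoid using (sum-permute)

  module _ {p : ℕ} .{{_ : NonZero p}} where

    toℕ-mod : ∀ m → toℕ (m mod p) ≡ m % p
    toℕ-mod m = toℕ-fromℕ< _

    [m%p+n]%p≡[m+n]%p : ∀ m n → (m % p + n) % p ≡ (m + n) % p
    [m%p+n]%p≡[m+n]%p m n = trans (%-distribˡ-+ (m % p) n p)
      (trans (cong (λ t → (t + n % p) % p) (m%n%n≡m%n m p)) (sym (%-distribˡ-+ m n p)))

    [m+n%p]%p≡[m+n]%p : ∀ m n → (m + n % p) % p ≡ (m + n) % p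
    [m+n%p]%p≡[m+n]%p m n = trans (cong (_% p) (+-comm m (n % p)))
      (trans ([m%p+n]%p≡[m+n]%p n m) (cong (_% p) (+-comm n m)))

    toℕ-0F : toℕ (0 mod p) ≡ 0
    toℕ-0F = trans (toℕ-mod 0) (m<n⇒m%n≡m (>-nonZero⁻¹ p))

    +F-comm : ∀ (a b : Fin p) → a +F b ≡ b +F a
    +F-comm a b = cong (_mod p) (+-comm (toℕ a) (toℕ b))

    +F-assoc : ∀ (a b c : Fin p) → (a +F b) +F c ≡ a +F (b +F c)
    +F-assoc a b c = toℕ-injective (begin
      toℕ ((a +F b) +F c)                              ≡⟨ toℕ-mod _ ⟩
      (toℕ (a +F b) + toℕ c) % p                       ≡⟨ cong (λ t → (t + toℕ c) % p) (toℕ-mod _) ⟩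
      ((toℕ a + toℕ b) % p + toℕ c) % p                ≡⟨ [m%p+n]%p≡[m+n]%p _ _ ⟩
      (toℕ a + toℕ b + toℕ c) % p                      ≡⟨ cong (_% p) (+-assoc (toℕ a) _ _) ⟩
      (toℕ a + (toℕ b + toℕ c)) % p                    ≡⟨ [m+n%p]%p≡[m+n]%p _ _ ⟨
      (toℕ a + (toℕ b + toℕ c) % p) % p                ≡⟨ cong (λ t → (toℕ a + t) % p) (toℕ-mod _) ⟨
      (toℕ a + toℕ (b +F c)) % p                       ≡⟨ toℕ-mod _ ⟨
      toℕ (a +F (b +F c))                              ∎)
      where open ≡-Reasoning

    +F-identityʳ : ∀ (a : Fin p) → a +F (0 mod p) ≡ a
    +F-identityʳ a = toℕ-injective (begin
      toℕ (a +F (0 mod p))             ≡⟨ toℕ-mod _ ⟩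
      (toℕ a + toℕ (0 mod p)) % p      ≡⟨ cong (λ t → (toℕ a + t) % p) toℕ-0F ⟩
      (toℕ a + 0) % p                  ≡⟨ cong (_% p) (+-identityʳ (toℕ a)) ⟩
      toℕ a % p                        ≡⟨ m<n⇒m%n≡m (toℕ<n a) ⟩
      toℕ a                            ∎)
      where open ≡-Reasoning

    +F-inverseʳ : ∀ (a : Fin p) → a +F negF a ≡ 0 mod p
    +F-inverseʳ a = toℕ-injective (begin
      toℕ (a +F negF a)                ≡⟨ toℕ-mod _ ⟩
      (toℕ a + toℕ (negF a)) % p       ≡⟨ cong (λ t → (toℕ a + t) % p) (toℕ-mod _) ⟩
      (toℕ a + (p ∸ toℕ a) % p) % p    ≡⟨ [m+n%p]%p≡[m+n]%p _ _ ⟩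
      (toℕ a + (p ∸ toℕ a)) % p        ≡⟨ cong (_% p) (m+[n∸m]≡n (<⇒≤ (toℕ<n a))) ⟩
      p % p                            ≡⟨ n%n≡0 p ⟩
      0                                ≡⟨ toℕ-0F ⟨
      toℕ (0 mod p)                    ∎)
      where open ≡-Reasoning

    ⊕-comm : ∀ {n} (x y : G p n) → x ⊕ y ≡ y ⊕ x
    ⊕-comm [] [] = refl
    ⊕-comm (a ∷ x) (b ∷ y) = cong₂ _∷_ (+F-comm a b) (⊕-comm x y)

    ⊕-assoc : ∀ {n} (x y z : G p n) → (x ⊕ y) ⊕ z ≡ x ⊕ (y ⊕ z)
    ⊕-assoc [] [] [] = refl
    ⊕-assoc (a ∷ x) (b ∷ y) (c ∷ z) = cong₂ _∷_ (+F-assoc a b c) (⊕-assoc x y z)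

    ⊕-identityʳ : ∀ {n} (x : G p n) → x ⊕ 0G ≡ x
    ⊕-identityʳ [] = refl
    ⊕-identityʳ (a ∷ x) = cong₂ _∷_ (+F-identityʳ a) (⊕-identityʳ x)

    ⊕-inverseʳ : ∀ {n} (x : G p n) → x ⊕ (⊖ x) ≡ 0G
    ⊕-inverseʳ [] = refl
    ⊕-inverseʳ (a ∷ x) = cong₂ _∷_ (+F-inverseʳ a) (⊕-inverseʳ x)

    [x⊕y]⊖y≡x : ∀ {n} (x y : G p n) → (x ⊕ y) ⊕ (⊖ y) ≡ x
    [x⊕y]⊖y≡x x y = trans (⊕-assoc x y (⊖ y)) (trans (cong (x ⊕_) (⊕-inverseʳ y)) (⊕-identityʳ x))

    [x⊕[y⊕z]]⊖y≡x⊕z : ∀ {n} (x y z : G p n) → (x ⊕ (y ⊕ z)) ⊕ (⊖ y) ≡ x ⊕ z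
    [x⊕[y⊕z]]⊖y≡x⊕z x y z =
      trans (⊕-assoc x (y ⊕ z) (⊖ y)) (cong (x ⊕_) (trans (cong (_⊕ (⊖ y)) (⊕-comm y z)) ([x⊕y]⊖y≡x z y)))

    Σlist-tabulate : ∀ {m} (h : Fin m → Fin p) (g : Fin p → ℕ) → Σlist (tabulate h) g ≡ Σfin (λ i → g (h i))
    Σlist-tabulate {zero} h g = refl
    Σlist-tabulate {suc m} h g = cong (g (h zero) +_) (Σlist-tabulate (λ i → h (suc i)) g)

    Σlist-allFin-+F : ∀ (c : Fin p) (g : Fin p → ℕ) → Σlist (allFin p) (λ a → g (a +F c)) ≡ Σlist (allFin p) g
    Σlist-allFin-+F c g = begin
      Σlist (allFin p) (λ a → g (a +F c))   ≡⟨ Σlist-tabulate (λ a → a) (λ a → g (a +F c)) ⟩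
      Σfin (λ a → g (a +F c))               ≡⟨ sum-permute g (permutation (_+F c) (_+F negF c) -c+c -c+c′) ⟨
      Σfin g                                ≡⟨ Σlist-tabulate (λ a → a) g ⟨
      Σlist (allFin p) g                    ∎
      where
      open ≡-Reasoning
      -c+c : ∀ a → (a +F negF c) +F c ≡ a
      -c+c a = trans (+F-assoc a (negF c) c) (trans (cong (a +F_) (trans (+F-comm (negF c) c) (+F-inverseʳ c))) (+F-identityʳ a))
      -c+c′ : ∀ a → (a +F c) +F negF c ≡ a
      -c+c′ a = trans (+F-assoc a c (negF c)) (trans (cong (a +F_) (+F-inverseʳ c)) (+F-identityʳ a))

    Σlist-allG-suc : ∀ n (g : G p (suc n) → ℕ) →
      Σlist (allG p (suc n)) g ≡ Σlist (allFin p) (λ a → Σlist (allG p n) (λ x → g (a ∷ x)))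
    Σlist-allG-suc n g = trans (Σlist-concatMap _ (allFin p) g)
      (IsSum.sum-cong (Σlist-isSum (allFin p)) (λ a → Σlist-map (a ∷_) (allG p n) g))

    Σlist-allG-⊕ : ∀ n (c : G p n) (g : G p n → ℕ) → Σlist (allG p n) (λ x → g (x ⊕ c)) ≡ Σlist (allG p n) g
    Σlist-allG-⊕ zero [] g = refl
    Σlist-allG-⊕ (suc n) (c₀ ∷ c) g = begin
      Σlist (allG p (suc n)) (λ x → g (x ⊕ (c₀ ∷ c)))
        ≡⟨ Σlist-allG-suc n (λ x → g (x ⊕ (c₀ ∷ c))) ⟩
      Σlist (allFin p) (λ a → Σlist (allG p n) (λ x → g ((a +F c₀) ∷ (x ⊕ c))))
        ≡⟨ IsSum.sum-cong (Σlist-isSum (allFin p)) (λ a → Σlist-allG-⊕ n c (λ x → g ((a +F c₀) ∷ x))) ⟩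
      Σlist (allFin p) (λ a → Σlist (allG p n) (λ x → g ((a +F c₀) ∷ x)))
        ≡⟨ Σlist-allFin-+F c₀ (λ a → Σlist (allG p n) (λ x → g (a ∷ x))) ⟩
      Σlist (allFin p) (λ a → Σlist (allG p n) (λ x → g (a ∷ x)))
        ≡⟨ Σlist-allG-suc n g ⟨
      Σlist (allG p (suc n)) g
        ∎
      where open ≡-Reasoning

    length-allG : ∀ n → length (allG p n) ≡ p ^ n
    length-allG zero = refl
    length-allG (suc n) = begin
      length (allG p (suc n))                                  ≡⟨ length≡Σlist1 (allG p (suc n)) ⟩
      Σlist (allG p (suc n)) (λ _ → 1)                         ≡⟨ Σlist-allG-suc n (λ _ → 1) ⟩
      Σlist (allFin p) (λ _ → Σlist (allG p n) (λ _ → 1))      ≡⟨ cong (λ t → Σlist (allFin p) (λ _ → t)) (trans (sym (length≡Σlist1 (allG p n))) (length-allG n)) ⟩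
      Σlist (allFin p) (λ _ → p ^ n)                           ≡⟨ Σlist-const (allFin p) (p ^ n) ⟩
      length (allFin p) * p ^ n                                ≡⟨ cong (_* p ^ n) (length-tabulate {n = p} (λ a → a)) ⟩
      p * p ^ n                                                ∎
      where
      open ≡-Reasoning
      length≡Σlist1 : ∀ {A : Set} (xs : List A) → length xs ≡ Σlist xs (λ _ → 1)
      length≡Σlist1 xs = sym (trans (Σlist-const xs 1) (*-identityʳ (length xs)))

module RationalBounds where

  open import Data.Nat as ℕ using (ℕ; zero; suc)
  import Data.Nat.Properties as ℕ
  open import Data.Integer as ℤ using (+_; -[1+_]; +≤+)
  import Data.Integer.Properties as ℤ
  open import Data.Rational using (ℚ; mkℚ; _≤_; _<_; _*_; _/_; 0ℚ; 1ℚ; _≤ᵇ_; toℚᵘ; *<*)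
  open import Data.Rational.Properties using (toℚᵘ-homo-*; toℚᵘ-cancel-≤; normalize-coprime; ≤⇒≤ᵇ)
  open import Data.Rational.Unnormalised as ℚᵘ using (ℚᵘ; mkℚᵘ; ↥_; ↧ₙ_; *≤*; 1ℚᵘ)
    renaming (_≤_ to _≤ᵘ_; _≃_ to _≃ᵘ_; _*_ to _*ᵘ_)
  import Data.Rational.Unnormalised.Properties as ℚᵘ
  open import Data.Nat.Coprimality using (1-coprimeTo; sym)
  open import Data.Bool using (true; T)
  open import Data.Product using (Σ; _×_; _,_)
  open import Data.Empty using (⊥-elim)
  open import Relation.Binary.PropositionalEquality hiding (sym)
  import Relation.Binary.PropositionalEquality as ≡
  open import Defs using (ℕtoℚ; _^ℚ_)

  Fraction : ℚᵘ → ℕ → ℕ → Set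
  Fraction q n d = (↥ q ≡ + n) × (↧ₙ q ≡ d)

  Fraction-* : ∀ p q {n₁ d₁ n₂ d₂} → Fraction p n₁ d₁ → Fraction q n₂ d₂ → Fraction (p *ᵘ q) (n₁ ℕ.* n₂) (d₁ ℕ.* d₂)
  Fraction-* (mkℚᵘ _ _) (mkℚᵘ _ _) {n₁} {_} {n₂} (↥p , ↧p) (↥q , ↧q) =
    trans (cong₂ ℤ._*_ ↥p ↥q) (≡.sym (ℤ.pos-* n₁ n₂)) , cong₂ ℕ._*_ ↧p ↧q

  Fraction-≤ : ∀ {p q n₁ d₁ n₂ d₂} → Fraction p n₁ d₁ → Fraction q n₂ d₂ → n₁ ℕ.* d₂ ℕ.≤ n₂ ℕ.* d₁ → p ≤ᵘ q
  Fraction-≤ {mkℚᵘ _ d₁-1} {mkℚᵘ _ d₂-1} {n₁} {_} {n₂} (refl , refl) (refl , refl) n₁d₂≤n₂d₁ =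
    *≤* (subst₂ ℤ._≤_ (ℤ.pos-* n₁ (suc d₂-1)) (ℤ.pos-* n₂ (suc d₁-1)) (+≤+ n₁d₂≤n₂d₁))

  _^ᵘ_ : ℚᵘ → ℕ → ℚᵘ
  q ^ᵘ zero = 1ℚᵘ
  q ^ᵘ suc k = q *ᵘ (q ^ᵘ k)

  Fraction-^ : ∀ q {n d} k → Fraction q n d → Fraction (q ^ᵘ k) (n ℕ.^ k) (d ℕ.^ k)
  Fraction-^ q zero _ = refl , refl
  Fraction-^ q (suc k) q≐n/d = Fraction-* q (q ^ᵘ k) q≐n/d (Fraction-^ q k q≐n/d)

  ^ᵘ-cong : ∀ {p q} k → p ≃ᵘ q → (p ^ᵘ k) ≃ᵘ (q ^ᵘ k)
  ^ᵘ-cong zero _ = ℚᵘ.≃-refl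
  ^ᵘ-cong (suc k) p≃q = ℚᵘ.*-cong p≃q (^ᵘ-cong k p≃q)

  toℚᵘ-homo-^ : ∀ q k → toℚᵘ (q ^ℚ k) ≃ᵘ (toℚᵘ q) ^ᵘ k
  toℚᵘ-homo-^ q zero = ℚᵘ.≃-refl
  toℚᵘ-homo-^ q (suc k) = ℚᵘ.≃-trans (toℚᵘ-homo-* q (q ^ℚ k)) (ℚᵘ.*-congˡ {toℚᵘ q} (toℚᵘ-homo-^ q k))

  Fraction-ℕtoℚ : ∀ m → Fraction (toℚᵘ (ℕtoℚ m)) m 1
  Fraction-ℕtoℚ m rewrite normalize-coprime {m} {0} (sym (1-coprimeTo m)) = refl , refl

  Fraction-1/30 : Fraction (toℚᵘ ((+ 1) / 30)) 1 30
  Fraction-1/30 rewrite normalize-coprime {1} {29} (1-coprimeTo 30) = refl , refl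

  Fraction-unit-interval : (δ : ℚ) → 0ℚ < δ → δ < 1ℚ →
    Σ ℕ λ a → Σ ℕ λ b → (1 ℕ.≤ a) × (a ℕ.< b) × Fraction (toℚᵘ δ) a b
  Fraction-unit-interval (mkℚ (+ zero) b-1 _) (*<* 0<0) _ = ⊥-elim (ℤ.<-irrefl refl (subst₂ ℤ._<_ (ℤ.*-zeroˡ (+ suc b-1)) (ℤ.*-identityʳ (+ 0)) 0<0))
  Fraction-unit-interval (mkℚ -[1+ n ] b-1 _) (*<* 0<δ) _ with subst₂ ℤ._<_ (ℤ.*-zeroˡ (+ suc b-1)) (ℤ.*-identityʳ -[1+ n ]) 0<δ
  ... | ()
  Fraction-unit-interval (mkℚ (+ suc a-1) b-1 _) _ (*<* δ<1) = suc a-1 , suc b-1 , ℕ.s≤s ℕ.z≤n ,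
    ℤ.drop‿+<+ (subst₂ ℤ._<_ (ℤ.*-identityʳ (+ suc a-1)) (ℤ.*-identityˡ (+ suc b-1)) δ<1) , refl , refl

  ≤ᵇ-fraction : ∀ δ a b D N → Fraction (toℚᵘ δ) a b → D ℕ.* b ℕ.≤ a ℕ.* N → (ℕtoℚ D ≤ᵇ δ * ℕtoℚ N) ≡ true
  ≤ᵇ-fraction δ a b D N δ≐a/b Db≤aN = T⇒≡true (≤⇒≤ᵇ (toℚᵘ-cancel-≤ D≤δN))
    where
    T⇒≡true : ∀ {b} → T b → b ≡ true
    T⇒≡true {true} _ = refl
    D≤δN : toℚᵘ (ℕtoℚ D) ≤ᵘ toℚᵘ (δ * ℕtoℚ N)
    D≤δN = ℚᵘ.≤-respʳ-≃ (ℚᵘ.≃-sym (toℚᵘ-homo-* δ (ℕtoℚ N)))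
      (Fraction-≤ (Fraction-ℕtoℚ D) (Fraction-* (toℚᵘ δ) (toℚᵘ (ℕtoℚ N)) δ≐a/b (Fraction-ℕtoℚ N))
        (subst₂ ℕ._≤_ (cong (D ℕ.*_) (≡.sym (ℕ.*-identityʳ b))) (≡.sym (ℕ.*-identityʳ (a ℕ.* N))) Db≤aN))

  [δ/30]^k*H≤S-fraction : ∀ δ a b k H S → Fraction (toℚᵘ δ) a b → a ℕ.^ k ℕ.* H ℕ.≤ (30 ℕ.* b) ℕ.^ k ℕ.* S →
    ((δ * ((+ 1) / 30)) ^ℚ k) * ℕtoℚ H ≤ ℕtoℚ S
  [δ/30]^k*H≤S-fraction δ a b k H S δ≐a/b a^kH≤[30b]^kS = toℚᵘ-cancel-≤ (ℚᵘ.≤-respˡ-≃ (ℚᵘ.≃-sym lhs≃) (Fraction-≤ lhs≐ (Fraction-ℕtoℚ S) cross))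
    where
    δ/30 : ℚᵘ
    δ/30 = toℚᵘ δ *ᵘ toℚᵘ ((+ 1) / 30)
    lhs≃ : toℚᵘ (((δ * ((+ 1) / 30)) ^ℚ k) * ℕtoℚ H) ≃ᵘ (δ/30 ^ᵘ k) *ᵘ toℚᵘ (ℕtoℚ H)
    lhs≃ = ℚᵘ.≃-trans (toℚᵘ-homo-* ((δ * ((+ 1) / 30)) ^ℚ k) (ℕtoℚ H))
             (ℚᵘ.*-congʳ {toℚᵘ (ℕtoℚ H)} (ℚᵘ.≃-trans (toℚᵘ-homo-^ (δ * ((+ 1) / 30)) k) (^ᵘ-cong k (toℚᵘ-homo-* δ ((+ 1) / 30)))))
    lhs≐ : Fraction ((δ/30 ^ᵘ k) *ᵘ toℚᵘ (ℕtoℚ H)) ((a ℕ.* 1) ℕ.^ k ℕ.* H) ((b ℕ.* 30) ℕ.^ k ℕ.* 1)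
    lhs≐ = Fraction-* (δ/30 ^ᵘ k) (toℚᵘ (ℕtoℚ H)) (Fraction-^ δ/30 k (Fraction-* (toℚᵘ δ) _ δ≐a/b Fraction-1/30)) (Fraction-ℕtoℚ H)
    cross : (a ℕ.* 1) ℕ.^ k ℕ.* H ℕ.* 1 ℕ.≤ S ℕ.* ((b ℕ.* 30) ℕ.^ k ℕ.* 1)
    cross = subst₂ ℕ._≤_
      (trans (≡.sym (ℕ.*-identityʳ _)) (cong (λ t → t ℕ.^ k ℕ.* H ℕ.* 1) (≡.sym (ℕ.*-identityʳ a))))
      (trans (ℕ.*-comm _ S) (cong (S ℕ.*_) (trans (cong (ℕ._^ k) (ℕ.*-comm 30 b)) (≡.sym (ℕ.*-identityʳ _)))))
      a^kH≤[30b]^kS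

  [δ/30]^k*H≤S : ∀ δ k H S → 0ℚ < δ → δ < 1ℚ →
    (∀ a b → 1 ℕ.≤ a → a ℕ.≤ b → Fraction (toℚᵘ δ) a b → a ℕ.^ k ℕ.* H ℕ.≤ (30 ℕ.* b) ℕ.^ k ℕ.* S) →
    ((δ * ((+ 1) / 30)) ^ℚ k) * ℕtoℚ H ≤ ℕtoℚ S
  [δ/30]^k*H≤S δ k H S 0<δ δ<1 bound with Fraction-unit-interval δ 0<δ δ<1
  ... | a , b , 1≤a , a<b , δ≐a/b = [δ/30]^k*H≤S-fraction δ a b k H S δ≐a/b (bound a b 1≤a (ℕ.<⇒≤ a<b) δ≐a/b)

module GreedyNet {A : Set} (Far : A → A → Set) (Far? : ∀ x y → Dec (Far x y)) where

  open import Data.Bool using (if_then_else_)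
  open import Data.List using ([]; _∷_)
  open import Data.List.Membership.Propositional using (_∈_)
  open import Data.List.Relation.Unary.Any using (here; there)
  open import Data.List.Relation.Unary.All using (All; []; _∷_; all?)
  open import Data.List.Relation.Unary.AllPairs using (AllPairs; []; _∷_)
  open import Data.Product using (Σ; _×_; _,_)
  open import Relation.Nullary using (¬_; does; yes; no; contradiction)
  open import Relation.Binary.PropositionalEquality using (refl)

  net : List A → List A
  net [] = []
  net (x ∷ xs) = if does (all? (Far? x) (net xs)) then x ∷ net xs else net xs

  net-⊆ : ∀ xs {c} → c ∈ net xs → c ∈ xs
  net-⊆ (x ∷ xs) c∈ with all? (Far? x) (net xs)
  net-⊆ (x ∷ xs) (here refl) | yes _ = here refl
  net-⊆ (x ∷ xs) (there c∈) | yes _ = there (net-⊆ xs c∈)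
  ... | no _ = there (net-⊆ xs c∈)

  net-separated : ∀ xs → AllPairs Far (net xs)
  net-separated [] = []
  net-separated (x ∷ xs) with all? (Far? x) (net xs)
  ... | yes x-far = x-far ∷ net-separated xs
  ... | no _ = net-separated xs

  net-covers : (∀ x → ¬ Far x x) → ∀ xs {x} → x ∈ xs → Σ A λ c → c ∈ net xs × ¬ Far x c
  net-covers irrefl (x ∷ xs) (here refl) with all? (Far? x) (net xs)
  ... | yes _ = x , here refl , irrefl x
  ... | no ¬x-far = near (net xs) ¬x-far
    where
    near : ∀ cs → ¬ All (Far x) cs → Σ A λ c → c ∈ cs × ¬ Far x c
    near [] ¬all = contradiction [] ¬all
    near (c ∷ cs) ¬all with Far? x c
    ... | no ¬far = c , here refl , ¬far
    ... | yes far with near cs (λ all → ¬all (far ∷ all))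
    ...   | c′ , c′∈ , ¬far = c′ , there c′∈ , ¬far
  net-covers irrefl (y ∷ xs) (there x∈) with net-covers irrefl xs x∈ | all? (Far? y) (net xs)
  ... | c , c∈ , ¬far | yes _ = c , there c∈ , ¬far
  ... | c , c∈ , ¬far | no _ = c , c∈ , ¬far

module StabiliserBound {p : ℕ} .{{_ : NonZero p}} {n : ℕ} (H A : SubsetG p n) (isH : IsSubgroup H)
                       (δ : ℚ) (a b : ℕ) (δ≐a/b : RationalBounds.Fraction (toℚᵘ δ) a b) where

  open import Data.Nat
  open import Data.Nat.Properties
  open import Data.Bool using (Bool; true; false; _xor_; _∧_)
  open import Data.Bool.Properties using (T?; T-≡)
  open import Data.List using (length; filter) renaming (map to mapL)
  open import Data.List.Properties using (length-map)
  open import Data.List.Membership.Propositional using (_∈_)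
  open import Data.List.Membership.Propositional.Properties using (∈-filter⁻; ∈-map⁻)
  open import Data.List.Relation.Unary.AllPairs as AllPairs using ()
  open import Data.List.Relation.Unary.AllPairs.Properties using (map⁺)
  open import Data.Fin using (Fin)
  open import Data.Product using (Σ; _×_; _,_; proj₂)
  open import Relation.Nullary using (¬_; does; yes; no)
  open import Relation.Nullary.Decidable using (dec-true)
  open import Function.Bundles using (Equivalence)
  open import Relation.Binary.PropositionalEquality
  open FiniteSums
  open VectorSpace
  open RationalBounds using (≤ᵇ-fraction)
  open IsSubgroup isH

  xs : List (G p n)
  xs = allG p n

  open Packing xs

  -- shift y is the indicator function of the translate A − y.
  shift : G p n → (G p n → Bool)
  shift y x = A (x ⊕ y)

  Close Far : G p n → G p n → Set
  Close x y = b * dist (shift x) (shift y) ≤ a * N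
  Far x y = a * N < b * dist (shift x) (shift y)

  Close? : ∀ x y → Dec (Close x y)
  Close? x y = b * dist (shift x) (shift y) ≤? a * N

  Far? : ∀ x y → Dec (Far x y)
  Far? x y = a * N <? b * dist (shift x) (shift y)

  open GreedyNet Far Far?

  ∣∣G≡Σ𝟙 : ∀ (X : SubsetG p n) → ∣ X ∣G ≡ Σlist xs (λ x → 𝟙 (X x))
  ∣∣G≡Σ𝟙 X = trans (length-filter≡Σlist (λ x → T? (X x)) xs) (IsSum.sum-cong (Σlist-isSum xs) (λ x → cong 𝟙 (does-T? (X x))))
    where
    does-T? : ∀ u → does (T? u) ≡ u
    does-T? true = refl
    does-T? false = refl

  ¬Far-refl : ∀ x → ¬ Far x x
  ¬Far-refl x far = n≮0 (subst (a * N <_) (trans (cong (b *_) (dist-self (shift x))) (*-zeroʳ b)) far)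

  dist-shift : ∀ z c → dist (shift (z ⊕ c)) (shift c) ≡ ∣ A Δ translate A z ∣G
  dist-shift z c = begin
    Σlist xs (λ x → 𝟙 (A (x ⊕ (z ⊕ c)) xor A (x ⊕ c)))
      ≡⟨ IsSum.sum-cong (Σlist-isSum xs) (λ x → cong (λ y → 𝟙 (A (x ⊕ (z ⊕ c)) xor A y)) ([x⊕[y⊕z]]⊖y≡x⊕z x z c)) ⟨
    Σlist xs (λ x → 𝟙 (A (x ⊕ (z ⊕ c)) xor A ((x ⊕ (z ⊕ c)) ⊕ (⊖ z))))
      ≡⟨ Σlist-allG-⊕ n (z ⊕ c) (λ x → 𝟙 (A x xor A (x ⊕ (⊖ z)))) ⟩
    Σlist xs (λ x → 𝟙 (A x xor A (x ⊕ (⊖ z))))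
      ≡⟨ ∣∣G≡Σ𝟙 (A Δ translate A z) ⟨
    ∣ A Δ translate A z ∣G
      ∎
    where open ≡-Reasoning

  Close⇒Stab : ∀ c z → Close (z ⊕ c) c → Stab δ A z ≡ true
  Close⇒Stab c z close = ≤ᵇ-fraction δ a b ∣ A Δ translate A z ∣G ∣ (λ (_ : G p n) → true) ∣G δ≐a/b
    (subst₂ _≤_ (trans (*-comm b _) (cong (_* b) (dist-shift z c))) (cong (a *_) (sym ∣G∣≡N)) close)
    where
    ∣G∣≡N : ∣ (λ (_ : G p n) → true) ∣G ≡ N
    ∣G∣≡N = trans (∣∣G≡Σ𝟙 _) (trans (Σlist-const xs 1) (*-identityʳ N))

  H-cancelʳ : ∀ c z → H c ≡ true → H (z ⊕ c) ≡ true → H z ≡ true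
  H-cancelʳ c z c∈H z⊕c∈H = subst (λ t → H t ≡ true) ([x⊕y]⊖y≡x z c) (+-closed (z ⊕ c) (⊖ c) z⊕c∈H (neg-closed c c∈H))

  Hs : List (G p n)
  Hs = filter (λ x → T? (H x)) xs

  Cs : List (G p n)
  Cs = net Hs

  Cs⊆H : ∀ {c} → c ∈ Cs → H c ≡ true
  Cs⊆H c∈ = Equivalence.to T-≡ (proj₂ (∈-filter⁻ (λ x → T? (H x)) {xs = xs} (net-⊆ Hs c∈)))

  𝟙*𝟙≤𝟙 : ∀ {P : Set} u (P? : Dec P) w → (u ≡ true → P → w ≡ true) → 𝟙 (does (T? u)) * 𝟙 (does P?) ≤ 𝟙 w
  𝟙*𝟙≤𝟙 false P? w _ = z≤n
  𝟙*𝟙≤𝟙 true (no _) w _ = z≤n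
  𝟙*𝟙≤𝟙 true (yes p) w u⇒P⇒w rewrite u⇒P⇒w refl p = ≤-refl

  𝟙-Close≤𝟙-Stab∩H : ∀ c → H c ≡ true → ∀ z →
    𝟙 (does (T? (H (z ⊕ c)))) * 𝟙 (does (Close? (z ⊕ c) c)) ≤ 𝟙 ((Stab δ A ∩ H) z)
  𝟙-Close≤𝟙-Stab∩H c c∈H z = 𝟙*𝟙≤𝟙 (H (z ⊕ c)) (Close? (z ⊕ c) c) ((Stab δ A ∩ H) z)
    (λ z⊕c∈H close → cong₂ _∧_ (Close⇒Stab c z close) (H-cancelʳ c z c∈H z⊕c∈H))

  #Close≤∣Stab∩H∣ : ∀ {c} → H c ≡ true → Σlist Hs (λ h → 𝟙 (does (Close? h c))) ≤ ∣ Stab δ A ∩ H ∣G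
  #Close≤∣Stab∩H∣ {c} c∈H = begin
    Σlist Hs (λ h → 𝟙 (does (Close? h c)))
      ≡⟨ Σlist-filter (λ x → T? (H x)) xs _ ⟩
    Σlist xs (λ h → 𝟙 (does (T? (H h))) * 𝟙 (does (Close? h c)))
      ≡⟨ Σlist-allG-⊕ n c (λ h → 𝟙 (does (T? (H h))) * 𝟙 (does (Close? h c))) ⟨
    Σlist xs (λ z → 𝟙 (does (T? (H (z ⊕ c)))) * 𝟙 (does (Close? (z ⊕ c) c)))
      ≤⟨ IsSum.sum-mono-≤ (Σlist-isSum xs) (𝟙-Close≤𝟙-Stab∩H c c∈H) ⟩
    Σlist xs (λ z → 𝟙 ((Stab δ A ∩ H) z))
      ≡⟨ ∣∣G≡Σ𝟙 (Stab δ A ∩ H) ⟨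
    ∣ Stab δ A ∩ H ∣G
      ∎
    where open ≤-Reasoning

  ∣H∣≤∣Cs∣*∣Stab∩H∣ : ∣ H ∣G ≤ length Cs * ∣ Stab δ A ∩ H ∣G
  ∣H∣≤∣Cs∣*∣Stab∩H∣ = begin
    length Hs                                                    ≡⟨ trans (Σlist-const Hs 1) (*-identityʳ _) ⟨
    Σlist Hs (λ _ → 1)                                           ≤⟨ Σlist-mono-∈ Hs covered ⟩
    Σlist Hs (λ h → Σlist Cs (λ c → 𝟙 (does (Close? h c))))      ≡⟨ Σlist-swap (Σlist-isSum Cs) Hs _ ⟩
    Σlist Cs (λ c → Σlist Hs (λ h → 𝟙 (does (Close? h c))))      ≤⟨ Σlist-mono-∈ Cs (λ c c∈ → #Close≤∣Stab∩H∣ (Cs⊆H c∈)) ⟩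
    Σlist Cs (λ _ → ∣ Stab δ A ∩ H ∣G)                            ≡⟨ Σlist-const Cs _ ⟩
    length Cs * ∣ Stab δ A ∩ H ∣G                                 ∎
    where
    open ≤-Reasoning
    covered : ∀ h → h ∈ Hs → 1 ≤ Σlist Cs (λ c → 𝟙 (does (Close? h c)))
    covered h h∈ with net-covers ¬Far-refl Hs h∈
    ... | c , c∈ , ¬far = subst (_≤ Σlist Cs (λ c → 𝟙 (does (Close? h c)))) (cong 𝟙 (dec-true (Close? h c) (≮⇒≥ ¬far)))
                                (∈⇒≤Σlist (λ c → 𝟙 (does (Close? h c))) c∈)

  VCdim-shifts : ∀ k → VCdimAtMost H A k → FamilyVCdim≤ k (mapL shift Cs)
  VCdim-shifts k vc zero _ _ = z≤n
  VCdim-shifts k vc (suc d) x shattered = vc (suc d) (s≤s z≤n) (x , witness)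
    where
    witness : (S : Fin (suc d) → Bool) → Σ (G p n) λ y → (H y ≡ true) × (∀ i → A (x i ⊕ y) ≡ S i)
    witness S with shattered S
    ... | F , F∈ , F|x≡S with ∈-map⁻ shift F∈
    ...   | y , y∈Cs , refl = y , Cs⊆H y∈Cs , F|x≡S

  stabiliser-bound : ∀ k → VCdimAtMost H A k → 1 ≤ a → a ≤ b → a ^ k * ∣ H ∣G ≤ (30 * b) ^ k * ∣ Stab δ A ∩ H ∣G
  stabiliser-bound k vc 1≤a a≤b = begin
    a ^ k * ∣ H ∣G                           ≤⟨ *-monoʳ-≤ (a ^ k) ∣H∣≤∣Cs∣*∣Stab∩H∣ ⟩
    a ^ k * (length Cs * S)                  ≡⟨ trans (sym (*-assoc (a ^ k) (length Cs) S)) (cong (_* S) (*-comm (a ^ k) (length Cs))) ⟩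
    length Cs * a ^ k * S                    ≤⟨ *-monoˡ-≤ S (subst (λ t → t * a ^ k ≤ (30 * b) ^ k) (length-map shift Cs) packed) ⟩
    (30 * b) ^ k * S                         ∎
    where
    open ≤-Reasoning
    S : ℕ
    S = ∣ Stab δ A ∩ H ∣G
    1≤N : 1 ≤ N
    1≤N = subst (1 ≤_) (sym (length-allG n)) (>-nonZero⁻¹ (p ^ n) {{m^n≢0 p n}})
    packed : length (mapL shift Cs) * a ^ k ≤ (30 * b) ^ k
    packed = packing a b k (mapL shift Cs) 1≤a a≤b 1≤N (map⁺ (AllPairs.map <⇒≤ (net-separated Hs))) (VCdim-shifts k vc)

open import Data.Nat.Primality using (Prime)
open import Data.Rational using (_<_; _≤_; _*_; _/_; 0ℚ; 1ℚ)
open import Data.Integer using (+_)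
open RationalBounds using ([δ/30]^k*H≤S)
open StabiliserBound using (stabiliser-bound)

lemma2p8 : (p : ℕ) .{{_ : NonZero p}} → Prime p → (n k : ℕ) → (δ : ℚ) → 0ℚ < δ → δ < 1ℚ →
    (H A : SubsetG p n) → IsSubgroup H → VCdimAtMost H A k →
      ((δ * ((+ 1) / 30)) ^ℚ k) * ℕtoℚ ∣ H ∣G ≤ ℕtoℚ ∣ Stab δ A ∩ H ∣G
lemma2p8 p _ n k δ 0<δ δ<1 H A isH vc = [δ/30]^k*H≤S δ k ∣ H ∣G ∣ Stab δ A ∩ H ∣G 0<δ δ<1
  (λ a b 1≤a a≤b δ≐a/b → stabiliser-bound H A isH δ a b δ≐a/b k vc 1≤a a≤b)
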